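{- For $P\simeq\Delta^3$ (the tetrahedron) no straightening along an edge is defined. Let $P\not\simeq\Delta^3$ be a simple $3$-polytope and $E=F_i\cap F_j$ an edge. The straightening along $E$ is defined if and only if there is no $3$-belt of the form $(F_i,F_j,F_k)$ for any facet $F_k$.
   Context: All polytopes are convex simple $3$-polytopes (each vertex in exactly $3$ facets), considered up to combinatorial equivalence. $(s,k)$-truncation: given a $k$-gonal facet $F$ of a simple $3$-polytope $Q$ and $s+2$ successive edges $E_0,E_1,\dots,E_s,E_{s+1}$ of $F$, $0\leqslant s\leqslant k-2$, cut $Q$ by a plane separating the edges $E_1,\dots,E_s$ (or a vertex if $s=0$) from the remaining vertices and crossing $E_0$ and $E_{s+1}$; combinatorially, the graph of the result is obtained from the graph of $Q$ by subdividing $E_0$ and $E_{s+1}$ at new vertices and joining these by a new edge $E$, so that $F$ splits into an $(s+3)$-gon $F'$ and a $(k-s+1)$-gon $F''$ with $F'\cap F''=E$. Straightening along an edge: if $E=F'\cap F''$ is an edge of $P$ and $P$ is combinatorially obtained from some simple $3$-polytope $Q$ by an $(s,k)$-truncation whose new edge is $E$ (with $F$ split into $F',F''$), then $Q$ (which is then unique up to combinatorial equivalence) is said to be obtained from $P$ by straightening along $E$, and the straightening along $E$ is said to be defined. A $3$-belt is a cyclic sequence of three facets pairwise intersecting in edges with empty triple intersection. -}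

module Defs where

open import Data.Nat using (ℕ; zero; suc; _+_; _*_; _≤_; _<_; _∸_)
open import Data.Nat.DivMod using (_mod_)
open import Data.Bool using (Bool; true; false; if_then_else_; not; _∧_)
open import Data.Fin using (Fin; toℕ) renaming (zero to fzero; suc to fsuc)
open import Data.Fin.Properties using () renaming (_≟_ to _≟ᶠ_)
open import Data.Product using (Σ; ∃; ∃-syntax; _×_; _,_)
open import Data.Sum using (_⊎_)
open import Relation.Nullary using (¬_)
open import Relation.Nullary.Decidable using (⌊_⌋)
open import Relation.Binary.PropositionalEquality using (_≡_; _≢_)
open import Function.Bundles using (_⇔_; _↔_; Inverse)

-- A simple 3-polytope P with n facets F_0,…,F_{n-1} is encoded by its
-- vertex incidence: tri a b c = true  iff  F_a ∩ F_b ∩ F_c is a vertex.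
-- (In a simple 3-polytope every vertex is determined by its 3 facets.)
-- Equivalently this is the boundary complex of the dual simplicial
-- polytope, i.e. a simplicial 2-sphere (Steinitz).

sumᶠ : ∀ {n} → (Fin n → ℕ) → ℕ
sumᶠ {zero}  f = 0
sumᶠ {suc n} f = f fzero + sumᶠ (λ x → f (fsuc x))

countᶠ : ∀ {n} → (Fin n → Bool) → ℕ
countᶠ p = sumᶠ (λ x → if p x then 1 else 0)

count3 : ∀ {n} → (Fin n → Fin n → Fin n → Bool) → ℕ
count3 T = sumᶠ (λ a → sumᶠ (λ b → countᶠ (T a b)))

data Reach {A : Set} (R : A → A → Set) : A → A → Set where
  here : ∀ {x} → Reach R x x
  step : ∀ {x y z} → R x y → Reach R y z → Reach R x z

-- F_a ∩ F_b is an edge  (iff it contains a vertex, for simple 3-polytopes)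
AdjT : ∀ {n} → (Fin n → Fin n → Fin n → Bool) → Fin n → Fin n → Set
AdjT {n} T a b = Σ (Fin n) (λ c → T a b c ≡ true)

-- The vertex-incidence data of a simple 3-polytope: a connected closed
-- combinatorial surface (every edge in exactly two vertices, every facet's
-- boundary a single cycle) with Euler characteristic 2,
-- i.e. n - (#vertices)/2 = 2, i.e. 6·#vertices = count3 T = 12 n - 24.
record IsSimple3Polytope (n : ℕ) (T : Fin n → Fin n → Fin n → Bool) : Set where
  field
    irrefl    : ∀ a c → T a a c ≡ false
    sym₁      : ∀ a b c → T a b c ≡ T b a c
    sym₂      : ∀ a b c → T a b c ≡ T a c b
    nonempty  : ∀ a → Σ (Fin n) (λ b → Σ (Fin n) (λ c → T a b c ≡ true))
    edge2     : ∀ a b → AdjT T a b → countᶠ (T a b) ≡ 2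
    linkConn  : ∀ a b c → AdjT T a b → AdjT T a c →
                Reach (λ x y → T a x y ≡ true) b c
    connected : ∀ a b → Reach (AdjT T) a b
    euler     : count3 T + 24 ≡ 12 * n

record SimplePolytope : Set where
  field
    n        : ℕ
    tri      : Fin n → Fin n → Fin n → Bool
    isSimple : IsSimple3Polytope n tri

open SimplePolytope public

IsEdge : (P : SimplePolytope) → Fin (n P) → Fin (n P) → Set
IsEdge P = AdjT (tri P)

Belt3 : (P : SimplePolytope) → Fin (n P) → Fin (n P) → Fin (n P) → Set
Belt3 P i j k = IsEdge P i j × IsEdge P j k × IsEdge P i k × tri P i j k ≡ false

distinct3 : Fin 4 → Fin 4 → Fin 4 → Bool
distinct3 a b c = not ⌊ a ≟ᶠ b ⌋ ∧ not ⌊ b ≟ᶠ c ⌋ ∧ not ⌊ a ≟ᶠ c ⌋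

-- P ≃ Δ³ (combinatorial equivalence = relabelling of facets preserving vertices)
IsTetrahedron : SimplePolytope → Set
IsTetrahedron P = Σ (Fin (n P) ↔ Fin 4) λ σ →
  ∀ a b c → tri P a b c ≡ distinct3 (Inverse.to σ a) (Inverse.to σ b) (Inverse.to σ c)

next : ∀ {k} → Fin k → Fin k
next {suc k} t = suc (toℕ t) mod (suc k)

-- A k-gonal facet F of Q together with a cyclic enumeration
-- G_{g 0}, …, G_{g (k-1)} of its neighbours, so that its edges are
-- E_t = F ∩ G_{g t} in cyclic order and its vertices are
-- F ∩ G_{g t} ∩ G_{g (t+1)}.
record FacetCycle (Q : SimplePolytope) (F : Fin (n Q)) (k : ℕ) (g : Fin k → Fin (n Q)) : Set where
  field
    g-inj : ∀ t u → g t ≡ g u → t ≡ u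
    g-cyc : ∀ b c → (tri Q F b c ≡ true) ⇔
              (Σ (Fin k) λ t → (b ≡ g t × c ≡ g (next t)) ⊎ (b ≡ g (next t) × c ≡ g t))

-- P is combinatorially obtained from Q by an (s,k)-truncation at the facet
-- F of Q along successive edges E_0,…,E_{s+1} (E_t = F ∩ G_{g t}), where
-- F splits into F' = F_i (an (s+3)-gon) and F'' = F_j (a (k-s+1)-gon) with
-- new edge E = F_i ∩ F_j.  φ identifies facets of P with facets of Q
-- (F_i, F_j ↦ F, bijective otherwise).
record Truncation (P Q : SimplePolytope) (i j : Fin (n P)) : Set where
  field
    F     : Fin (n Q)
    k     : ℕ
    g     : Fin k → Fin (n Q)
    cyc   : FacetCycle Q F k g
    s     : ℕ
    s≤k-2 : s + 2 ≤ k
    φ     : Fin (n P) → Fin (n Q)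
    i≢j   : i ≢ j
    φi    : φ i ≡ F
    φj    : φ j ≡ F
    φ-inj : ∀ x y → φ x ≡ φ y → x ≡ y ⊎ (x ≡ i × y ≡ j) ⊎ (x ≡ j × y ≡ i)
    φ-sur : ∀ z → Σ (Fin (n P)) λ x → φ x ≡ z
    -- vertices of P not on E_... : old vertices of Q not on F
    oldV  : ∀ a b c → a ≢ i → a ≢ j → b ≢ i → b ≢ j → c ≢ i → c ≢ j →
              tri P a b c ≡ tri Q (φ a) (φ b) (φ c)
    -- vertices of F' : the old vertices of F between E_0 and E_{s+1}
    F'V   : ∀ b c → b ≢ i → b ≢ j → c ≢ i → c ≢ j →
              (tri P i b c ≡ true) ⇔
              (Σ (Fin k) λ t → toℕ t ≤ s ×
                 ((φ b ≡ g t × φ c ≡ g (next t)) ⊎ (φ b ≡ g (next t) × φ c ≡ g t)))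
    -- vertices of F'' : the remaining old vertices of F
    F''V  : ∀ b c → b ≢ i → b ≢ j → c ≢ i → c ≢ j →
              (tri P j b c ≡ true) ⇔
              (Σ (Fin k) λ t → s < toℕ t ×
                 ((φ b ≡ g t × φ c ≡ g (next t)) ⊎ (φ b ≡ g (next t) × φ c ≡ g t)))
    -- the two new vertices: endpoints of E, subdividing E_0 and E_{s+1}
    newV  : ∀ b → b ≢ i → b ≢ j →
              (tri P i j b ≡ true) ⇔
              (Σ (Fin k) λ t → (toℕ t ≡ 0 ⊎ toℕ t ≡ suc s) × φ b ≡ g t)

-- Straightening along E = F_i ∩ F_j is defined: P is obtained from some
-- simple 3-polytope Q by an (s,k)-truncation whose new edge is E.
StraighteningDefined : (P : SimplePolytope) → Fin (n P) → Fin (n P) → Set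
StraighteningDefined P i j =
  Σ SimplePolytope λ Q → Truncation P Q i j ⊎ Truncation P Q j i

module Submission where

-- Δ³.  A truncation adds a facet (truncation-adds-facet) and every simple
-- polytope has at least four facets (atLeastFourFacets); Δ³ has four.
--
-- ⇒.  If P is a truncation of Q with new edge F_i ∩ F_j, a common neighbour
-- of F_i and F_j meets the truncated facet along E_0 or E_{s+1}, so it
-- contains an endpoint of the new edge (truncation-edge-in-no-belt).
--
-- ⇐.  Otherwise merge i and j into one facet (modules Merge, Straighten).
-- The links of facets of Q are cycles: by the general theory of 2-regular
-- relations (CycleFacts, TraceCycle) for the untouched facets, and by
-- concatenating the polygons of i and j for the merged facet, which needs
-- that P has no 3-belt through i ∩ j and is not Δ³.  Connectivity of Q is
-- inherited from P, and Euler's relation follows by counting polygon lengths.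
-- Finally P is the truncation of Q at the merged facet.

open import Defs
open import Data.Nat using (ℕ; zero; suc; _+_; _*_; _∸_; _≤_; _<_; _<?_; pred; z≤n; s≤s) renaming (_≟_ to _≟ℕ_)
open import Data.Nat.Properties using (+-comm; +-suc; +-identityʳ; +-cancelʳ-≡; +-cancelˡ-<; +-monoʳ-<; *-distribˡ-+; *-cancelˡ-≡; <-cmp; <-irrefl; <-trans; <⇒≢; <⇒≤; ≤-refl; ≤-trans; ≤-antisym; ≤-pred; ≤-total; ≤-reflexive; ≮⇒≥; n<1+n; n≤1+n; m≤m+n; m≤n⇒m≤1+n; m≤n⇒m<n∨m≡n; m+n∸m≡n; m+[n∸m]≡n; suc-injective)
open import Data.Nat.DivMod using (_%_; m<n⇒m%n≡m; n%n≡0)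
open import Data.Nat.Tactic.RingSolver using (solve-∀)
open import Data.Bool using (Bool; true; false; _∧_; _∨_; not; if_then_else_)
import Data.Bool as Bool
open import Data.Bool.Properties using (∨-zeroʳ; ∨-idem; ¬-not)
open import Data.Fin using (Fin; toℕ; fromℕ<; punchIn; punchOut) renaming (zero to fzero; suc to fsuc)
open import Data.Fin.Patterns using (0F; 1F; 2F; 3F)
open import Data.Fin.Properties using (any?; pigeonhole; injective⇒≤; toℕ-injective; toℕ-fromℕ<; toℕ<n; punchIn-injective; punchIn-punchOut; punchInᵢ≢i; punchOut-cong; punchOut-punchIn) renaming (_≟_ to _≟ᶠ_)
open import Data.Product using (Σ; _×_; _,_; proj₁; proj₂)
open import Data.Sum using (_⊎_; inj₁; inj₂)
open import Data.Empty using (⊥; ⊥-elim)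
open import Relation.Nullary using (¬_; Dec; yes; no; does)
open import Relation.Nullary.Decidable using (dec-true; dec-false)
open import Relation.Binary using (tri<; tri≈; tri>)
open import Relation.Binary.PropositionalEquality using (_≡_; _≢_; refl; sym; trans; cong; cong₂; subst; subst₂; module ≡-Reasoning)
open import Function.Bundles using (Equivalence; Inverse; Injection; _⇔_; mk↔ₛ′; mk⇔)
open import Function.Properties.Inverse using (↔⇒↣)

eqB : ∀ {n} → Fin n → Fin n → Bool
eqB x y = does (x ≟ᶠ y)

eqB-refl : ∀ {n} (x : Fin n) → eqB x x ≡ true
eqB-refl x = dec-true (x ≟ᶠ x) refl

eqB-≢ : ∀ {n} {x y : Fin n} → x ≢ y → eqB x y ≡ false
eqB-≢ {x = x} {y} = dec-false (x ≟ᶠ y)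

eqB-true : ∀ {n} {x y : Fin n} → eqB x y ≡ true → x ≡ y
eqB-true {x = x} {y} e with x ≟ᶠ y
... | yes x≡y = x≡y
eqB-true {x = x} {y} () | no _

eqB-suc : ∀ {n} (x y : Fin n) → eqB (fsuc x) (fsuc y) ≡ eqB x y
eqB-suc x y with x ≟ᶠ y
... | yes _ = refl
... | no _ = refl

eqB-sym : ∀ {n} (x y : Fin n) → eqB x y ≡ eqB y x
eqB-sym x y with x ≟ᶠ y | y ≟ᶠ x
... | yes _ | yes _ = refl
... | no _ | no _ = refl
... | yes x≡y | no y≢x = ⊥-elim (y≢x (sym x≡y))
... | no x≢y | yes y≡x = ⊥-elim (x≢y (sym y≡x))

true≢false : true ≢ false
true≢false ()

sumᶠ-ext : ∀ {n} (f g : Fin n → ℕ) → (∀ x → f x ≡ g x) → sumᶠ f ≡ sumᶠ g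
sumᶠ-ext {zero} f g f≗g = refl
sumᶠ-ext {suc n} f g f≗g =
  cong₂ _+_ (f≗g fzero) (sumᶠ-ext (λ x → f (fsuc x)) (λ x → g (fsuc x)) (λ x → f≗g (fsuc x)))

sumᶠ-+ : ∀ {n} (f g : Fin n → ℕ) → sumᶠ (λ x → f x + g x) ≡ sumᶠ f + sumᶠ g
sumᶠ-+ {zero} f g = refl
sumᶠ-+ {suc n} f g
  rewrite sumᶠ-+ (λ x → f (fsuc x)) (λ x → g (fsuc x)) =
  interchange (f fzero) (g fzero) (sumᶠ (λ x → f (fsuc x))) (sumᶠ (λ x → g (fsuc x)))
  where
  interchange : ∀ a b c d → a + b + (c + d) ≡ a + c + (b + d)
  interchange = solve-∀

sumᶠ-0 : ∀ {n} (f : Fin n → ℕ) → (∀ x → f x ≡ 0) → sumᶠ f ≡ 0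
sumᶠ-0 {zero} f f≗0 = refl
sumᶠ-0 {suc n} f f≗0 rewrite f≗0 fzero = sumᶠ-0 (λ x → f (fsuc x)) (λ x → f≗0 (fsuc x))

sumᶠ-2* : ∀ {n} (f : Fin n → ℕ) → sumᶠ (λ x → 2 * f x) ≡ 2 * sumᶠ f
sumᶠ-2* {zero} f = refl
sumᶠ-2* {suc n} f rewrite sumᶠ-2* (λ x → f (fsuc x)) =
  sym (*-distribˡ-+ 2 (f fzero) (sumᶠ (λ x → f (fsuc x))))

sumᶠ-ind : ∀ {n} (c : Fin n) (v : ℕ) → sumᶠ (λ x → if eqB x c then v else 0) ≡ v
sumᶠ-ind {suc n} fzero v = trans (cong (v +_) (sumᶠ-0 {n} (λ _ → 0) (λ _ → refl))) (+-identityʳ v)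
sumᶠ-ind {suc n} (fsuc c) v = trans (sumᶠ-ext _ _ shift) (sumᶠ-ind c v)
  where
  shift : ∀ x → (if eqB (fsuc x) (fsuc c) then v else 0) ≡ (if eqB x c then v else 0)
  shift x = cong (λ b → if b then v else 0) (eqB-suc x c)

sumᶠ-punch : ∀ {n} (j : Fin (suc n)) (f : Fin (suc n) → ℕ) →
  sumᶠ f ≡ f j + sumᶠ (λ x → f (punchIn j x))
sumᶠ-punch fzero f = refl
sumᶠ-punch {suc n} (fsuc j) f rewrite sumᶠ-punch j (λ x → f (fsuc x)) =
  swap (f fzero) (f (fsuc j)) (sumᶠ (λ x → f (fsuc (punchIn j x))))
  where
  swap : ∀ a b c → a + (b + c) ≡ b + (a + c)
  swap = solve-∀

count-ext : ∀ {n} (p q : Fin n → Bool) → (∀ x → p x ≡ q x) → countᶠ p ≡ countᶠ q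
count-ext p q p≗q = sumᶠ-ext _ _ (λ x → cong (λ b → if b then 1 else 0) (p≗q x))

count-0 : ∀ {n} (p : Fin n → Bool) → (∀ x → p x ≡ false) → countᶠ p ≡ 0
count-0 p none = sumᶠ-0 _ (λ x → cong (λ b → if b then 1 else 0) (none x))

count-0⇒ : ∀ {n} (p : Fin n → Bool) → countᶠ p ≡ 0 → ∀ x → p x ≡ false
count-0⇒ {suc n} p e x with p fzero in p0
count-0⇒ {suc n} p () x | true
count-0⇒ {suc n} p e fzero | false = p0
count-0⇒ {suc n} p e (fsuc x) | false = count-0⇒ (λ y → p (fsuc y)) e x

count-pos : ∀ {n} (p : Fin n → Bool) {m} → countᶠ p ≡ suc m → Σ (Fin n) λ a → p a ≡ true
count-pos {suc n} p e with p fzero in p0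
... | true = fzero , p0
... | false with count-pos (λ y → p (fsuc y)) e
... | a , pa = fsuc a , pa

count-remove : ∀ {n} (p : Fin n → Bool) (a : Fin n) → p a ≡ true →
  countᶠ p ≡ suc (countᶠ (λ x → p x ∧ not (eqB x a)))
count-remove {suc n} p fzero pa rewrite pa | eqB-refl {suc n} fzero =
  cong suc (count-ext _ _ keep)
  where
  keep : ∀ x → p (fsuc x) ≡ (p (fsuc x) ∧ not (eqB (fsuc x) fzero))
  keep x with p (fsuc x)
  ... | true = refl
  ... | false = refl
count-remove {suc n} p (fsuc a) pa
  rewrite count-remove (λ y → p (fsuc y)) a pa with p fzero
... | true = cong (λ z → suc (suc z)) (count-ext _ _ shift)
  where
  shift : ∀ x → (p (fsuc x) ∧ not (eqB x a)) ≡ (p (fsuc x) ∧ not (eqB (fsuc x) (fsuc a)))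
  shift x = cong (λ b → p (fsuc x) ∧ not b) (sym (eqB-suc x a))
... | false = cong suc (count-ext _ _ shift)
  where
  shift : ∀ x → (p (fsuc x) ∧ not (eqB x a)) ≡ (p (fsuc x) ∧ not (eqB (fsuc x) (fsuc a)))
  shift x = cong (λ b → p (fsuc x) ∧ not b) (sym (eqB-suc x a))

∧-not-true : ∀ {b c : Bool} → (b ∧ not c) ≡ true → b ≡ true × c ≡ false
∧-not-true {true} {false} e = refl , refl

∧-not-intro : ∀ {b c : Bool} → b ≡ true → c ≡ false → (b ∧ not c) ≡ true
∧-not-intro refl refl = refl

opaque
  count≡2⇒pair : ∀ {n} (p : Fin n → Bool) → countᶠ p ≡ 2 →
    Σ (Fin n) λ a → Σ (Fin n) λ b → a ≢ b × p a ≡ true × p b ≡ true ×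
      (∀ c → p c ≡ true → c ≡ a ⊎ c ≡ b)
  count≡2⇒pair {n} p e with count-pos p e
  ... | a , pa with count-pos (λ x → p x ∧ not (eqB x a)) count-p-a
    where
    count-p-a : countᶠ (λ x → p x ∧ not (eqB x a)) ≡ 1
    count-p-a = suc-injective (trans (sym (count-remove p a pa)) e)
  ... | b , pb' with ∧-not-true {p b} {eqB b a} pb'
  ... | pb , b≠a = a , b , a≢b , pa , pb , onlyTwo
    where
    a≢b : a ≢ b
    a≢b refl = true≢false (trans (sym (eqB-refl a)) b≠a)
    p-a : Fin n → Bool
    p-a x = p x ∧ not (eqB x a)
    count-p-a-b : countᶠ (λ x → p-a x ∧ not (eqB x b)) ≡ 0
    count-p-a-b = suc-injective (suc-injective
      (trans (sym (trans (count-remove p a pa) (cong suc (count-remove p-a b pb')))) e))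
    onlyTwo : ∀ c → p c ≡ true → c ≡ a ⊎ c ≡ b
    onlyTwo c pc with c ≟ᶠ a | c ≟ᶠ b
    ... | yes c≡a | _ = inj₁ c≡a
    ... | no _ | yes c≡b = inj₂ c≡b
    ... | no c≢a | no c≢b = ⊥-elim (true≢false (trans (sym inRest) (count-0⇒ _ count-p-a-b c)))
      where
      inRest : (p-a c ∧ not (eqB c b)) ≡ true
      inRest = ∧-not-intro (∧-not-intro pc (eqB-≢ c≢a)) (eqB-≢ c≢b)

count≡2-only : ∀ {n} (p : Fin n → Bool) → countᶠ p ≡ 2 → ∀ {u v c} →
  p u ≡ true → p v ≡ true → u ≢ v → p c ≡ true → c ≡ u ⊎ c ≡ v
count≡2-only p two {u} {v} {c} pu pv u≢v pc with count≡2⇒pair p two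
... | _ , _ , _ , _ , _ , only with only u pu | only v pv | only c pc
... | inj₁ refl | inj₁ refl | _ = ⊥-elim (u≢v refl)
... | inj₂ refl | inj₂ refl | _ = ⊥-elim (u≢v refl)
... | inj₁ refl | inj₂ refl | inj₁ refl = inj₁ refl
... | inj₁ refl | inj₂ refl | inj₂ refl = inj₂ refl
... | inj₂ refl | inj₁ refl | inj₁ refl = inj₂ refl
... | inj₂ refl | inj₁ refl | inj₂ refl = inj₁ refl

count-add : ∀ {n} (p q : Fin n → Bool) (c : Fin n) → q c ≡ false →
  (∀ x → p x ≡ (q x ∨ eqB x c)) → countᶠ p ≡ suc (countᶠ q)
count-add p q c qc p≗q+c = trans (count-remove p c pc) (cong suc (count-ext _ _ removeC))
  where
  pc : p c ≡ true
  pc = trans (p≗q+c c) (trans (cong (q c ∨_) (eqB-refl c)) (∨-zeroʳ (q c)))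
  removeC : ∀ x → (p x ∧ not (eqB x c)) ≡ q x
  removeC x rewrite p≗q+c x with x ≟ᶠ c
  ... | yes refl rewrite qc = refl
  ... | no _ with q x
  ... | true = refl
  ... | false = refl

count-two : ∀ {n} (p : Fin n → Bool) (a b : Fin n) → a ≢ b →
  (∀ c → p c ≡ true → c ≡ a ⊎ c ≡ b) → p a ≡ true → p b ≡ true → countᶠ p ≡ 2
count-two {n} p a b a≢b only pa pb =
  trans (count-add p isA b (eqB-≢ (λ e → a≢b (sym e))) p≗a+b)
    (cong suc (trans (count-add isA (λ _ → false) a refl (λ x → refl))
                     (cong suc (count-0 {n} _ (λ _ → refl)))))
  where
  isA : Fin n → Bool
  isA x = false ∨ eqB x a
  p≗a+b : ∀ x → p x ≡ (isA x ∨ eqB x b)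
  p≗a+b x with x ≟ᶠ a | x ≟ᶠ b
  ... | yes refl | _ = pa
  ... | no _ | yes refl = pb
  ... | no x≢a | no x≢b with p x in px
  ... | true with only x px
  ... | inj₁ x≡a = ⊥-elim (x≢a x≡a)
  ... | inj₂ x≡b = ⊥-elim (x≢b x≡b)
  p≗a+b x | no x≢a | no x≢b | false = refl

search : ∀ {n} (p : Fin n → Bool) → (Σ (Fin n) λ z → p z ≡ true) ⊎ (∀ z → p z ≡ false)
search p with any? (λ z → p z Bool.≟ true)
... | yes found = inj₁ found
... | no none = inj₂ (λ z → ¬-not (λ pz → none (z , pz)))

pick : ∀ {n} (p : Fin n → Bool) → Fin n → Fin n
pick p default with search p
... | inj₁ (z , _) = z
... | inj₂ _ = default

pick-spec : ∀ {n} (p : Fin n → Bool) d → Σ (Fin n) (λ z → p z ≡ true) → p (pick p d) ≡ true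
pick-spec p d (z , pz) with search p
... | inj₁ (_ , pz') = pz'
... | inj₂ none = ⊥-elim (true≢false (trans (sym pz) (none z)))

anyBelow : ℕ → (ℕ → Bool) → Bool
anyBelow zero f = false
anyBelow (suc k) f = anyBelow k f ∨ f k

anyBelow-true : ∀ k f → anyBelow k f ≡ true → Σ ℕ λ t → t < k × f t ≡ true
anyBelow-true (suc k) f e with anyBelow k f in below
... | true with anyBelow-true k f below
... | t , t<k , ft = t , m≤n⇒m≤1+n t<k , ft
anyBelow-true (suc k) f e | false = k , ≤-refl , e

anyBelow-intro : ∀ k f t → t < k → f t ≡ true → anyBelow k f ≡ true
anyBelow-intro (suc k) f t t<k ft with m≤n⇒m<n∨m≡n (≤-pred t<k)
... | inj₁ t<k' rewrite anyBelow-intro k f t t<k' ft = refl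
... | inj₂ refl rewrite ft = ∨-zeroʳ (anyBelow t f)

anyBelow-false : ∀ k f → (∀ t → t < k → f t ≡ false) → anyBelow k f ≡ false
anyBelow-false zero f none = refl
anyBelow-false (suc k) f none
  rewrite anyBelow-false k f (λ t t<k → none t (m≤n⇒m≤1+n t<k)) = none k ≤-refl

firstBelow : (f : ℕ → Bool) → ∀ b →
  (Σ ℕ λ q → q < b × f q ≡ true × (∀ q' → q' < q → f q' ≡ false)) ⊎ (∀ q → q < b → f q ≡ false)
firstBelow f zero = inj₂ (λ _ ())
firstBelow f (suc b) with firstBelow f b
... | inj₁ (q , q<b , fq , least) = inj₁ (q , m≤n⇒m≤1+n q<b , fq , least)
... | inj₂ none with f b in fb
... | true = inj₁ (b , ≤-refl , fb , none)
... | false = inj₂ (λ q q<1+b → upTo q (m≤n⇒m<n∨m≡n (≤-pred q<1+b)))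
  where
  upTo : ∀ q → q < b ⊎ q ≡ b → f q ≡ false
  upTo q (inj₁ q<b) = none q q<b
  upTo q (inj₂ refl) = fb

minimise : (f : ℕ → Bool) → ∀ b → f b ≡ true →
  Σ ℕ λ q → f q ≡ true × (∀ q' → q' < q → f q' ≡ false)
minimise f b fb with firstBelow f (suc b)
... | inj₁ (q , _ , fq , least) = q , fq , least
... | inj₂ none = ⊥-elim (true≢false (trans (sym fb) (none b ≤-refl)))

cong₃ : ∀ {A B : Set} (f : A → A → A → B) {x y z x' y' z'} →
  x ≡ x' → y ≡ y' → z ≡ z' → f x y z ≡ f x' y' z'
cong₃ f refl refl refl = refl

distinct4⇒4≤ : ∀ {N} (a b c d : Fin N) → a ≢ b → a ≢ c → a ≢ d → b ≢ c → b ≢ d → c ≢ d → 4 ≤ N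
distinct4⇒4≤ {N} a b c d a≢b a≢c a≢d b≢c b≢d c≢d = injective⇒≤ {f = f} f-inj
  where
  f : Fin 4 → Fin N
  f 0F = a
  f 1F = b
  f 2F = c
  f 3F = d
  f-inj : ∀ {x y} → f x ≡ f y → x ≡ y
  f-inj {0F} {0F} e = refl
  f-inj {0F} {1F} e = ⊥-elim (a≢b e)
  f-inj {0F} {2F} e = ⊥-elim (a≢c e)
  f-inj {0F} {3F} e = ⊥-elim (a≢d e)
  f-inj {1F} {0F} e = ⊥-elim (a≢b (sym e))
  f-inj {1F} {1F} e = refl
  f-inj {1F} {2F} e = ⊥-elim (b≢c e)
  f-inj {1F} {3F} e = ⊥-elim (b≢d e)
  f-inj {2F} {0F} e = ⊥-elim (a≢c (sym e))
  f-inj {2F} {1F} e = ⊥-elim (b≢c (sym e))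
  f-inj {2F} {2F} e = refl
  f-inj {2F} {3F} e = ⊥-elim (c≢d e)
  f-inj {3F} {0F} e = ⊥-elim (a≢d (sym e))
  f-inj {3F} {1F} e = ⊥-elim (b≢d (sym e))
  f-inj {3F} {2F} e = ⊥-elim (c≢d (sym e))
  f-inj {3F} {3F} e = refl

∨-true₁ : ∀ {a b : Bool} → a ≡ true → (a ∨ b) ≡ true
∨-true₁ refl = refl

∨-true₂ : ∀ {a b : Bool} → b ≡ true → (a ∨ b) ≡ true
∨-true₂ {a} refl = ∨-zeroʳ a

∨-elim : ∀ {a b : Bool} → (a ∨ b) ≡ true → a ≡ true ⊎ b ≡ true
∨-elim {true} _ = inj₁ refl
∨-elim {false} e = inj₂ e

∨-false : ∀ {a b : Bool} → a ≡ false → b ≡ false → (a ∨ b) ≡ false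
∨-false refl refl = refl

Rel : ℕ → Set
Rel n = Fin n → Fin n → Bool

Symm : ∀ {n} → Rel n → Set
Symm R = ∀ x y → R x y ≡ R y x

Supp : ∀ {n} → Rel n → Fin n → Set
Supp {n} R x = Σ (Fin n) λ y → R x y ≡ true

RReach : ∀ {n} → Rel n → Fin n → Fin n → Set
RReach R = Reach (λ x y → R x y ≡ true)

reach-trans : ∀ {A : Set} {R : A → A → Set} {x y z} → Reach R x y → Reach R y z → Reach R x z
reach-trans here q = q
reach-trans (step r p) q = step r (reach-trans p q)

EdgeAt : ∀ {n} → (ℕ → Fin n) → ℕ → Fin n → Fin n → Set
EdgeAt w t x y = (x ≡ w t × y ≡ w (suc t)) ⊎ (x ≡ w (suc t) × y ≡ w t)

edgeAt-cong : ∀ {n} {w v : ℕ → Fin n} {s t} {y z : Fin n} →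
  v t ≡ w s → v (suc t) ≡ w (suc s) → EdgeAt w s y z → EdgeAt v t y z
edgeAt-cong e₀ e₁ (inj₁ (a , b)) = inj₁ (trans a (sym e₀) , trans b (sym e₁))
edgeAt-cong e₀ e₁ (inj₂ (a , b)) = inj₂ (trans a (sym e₁) , trans b (sym e₀))

edgeAt-map : ∀ {n n'} {w : ℕ → Fin n} {t} {y z} (f : Fin n → Fin n') →
  EdgeAt w t y z → EdgeAt (λ s → f (w s)) t (f y) (f z)
edgeAt-map f (inj₁ (a , b)) = inj₁ (cong f a , cong f b)
edgeAt-map f (inj₂ (a , b)) = inj₂ (cong f a , cong f b)

record Cycle {n} (R : Rel n) : Set where
  field
    k      : ℕ
    w      : ℕ → Fin n
    k≥3    : 3 ≤ k
    wrap   : w k ≡ w 0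
    inj    : ∀ a b → a < k → b < k → w a ≡ w b → a ≡ b
    edges→ : ∀ x y → R x y ≡ true → Σ ℕ λ t → t < k × EdgeAt w t x y
    →edges : ∀ t → t < k → R (w t) (w (suc t)) ≡ true

edgeAt⇒R : ∀ {n} {R : Rel n} → Symm R → (C : Cycle R) → ∀ {s b c} →
  s < Cycle.k C → EdgeAt (Cycle.w C) s b c → R b c ≡ true
edgeAt⇒R symR C s<k (inj₁ (refl , refl)) = Cycle.→edges C _ s<k
edgeAt⇒R symR C s<k (inj₂ (refl , refl)) = trans (symR _ _) (Cycle.→edges C _ s<k)

module CycleIndexing {n} (k : ℕ) (w : ℕ → Fin n) (k≥3 : 3 ≤ k) (wrap : w k ≡ w 0)
  (inj : ∀ a b → a < k → b < k → w a ≡ w b → a ≡ b) where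

  k≥1 : 1 ≤ k
  k≥1 = ≤-trans (s≤s z≤n) k≥3

  norm : ∀ s → s ≤ k → Σ ℕ λ s' → s' < k × w s ≡ w s' × (s' ≡ s ⊎ (s ≡ k × s' ≡ 0))
  norm s s≤k with m≤n⇒m<n∨m≡n s≤k
  ... | inj₁ s<k = s , s<k , refl , inj₁ refl
  ... | inj₂ refl = 0 , k≥1 , wrap , inj₂ (refl , refl)

  prev : ℕ → ℕ
  prev zero = k ∸ 1
  prev (suc t) = t

  prev<k : ∀ t → t < k → prev t < k
  prev<k zero _ = pred<k k k≥1
    where
    pred<k : ∀ k → 1 ≤ k → k ∸ 1 < k
    pred<k (suc k) _ = ≤-refl
  prev<k (suc t) 1+t<k = <-trans ≤-refl 1+t<k

  w-prev : ∀ t → w (suc (prev t)) ≡ w t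
  w-prev zero = trans (cong w (1+pred k k≥1)) wrap
    where
    1+pred : ∀ k → 1 ≤ k → suc (k ∸ 1) ≡ k
    1+pred (suc k) _ = refl
  w-prev (suc t) = refl

  -- Since k ≥ 3 the successor and the predecessor of a vertex differ.
  nbr-distinct : ∀ t → t < k → w (suc t) ≢ w (prev t)
  nbr-distinct t t<k eq with norm (suc t) t<k
  nbr-distinct zero t<k eq | s' , s'<k , ws , inj₁ refl
    with inj 1 (k ∸ 1) s'<k (prev<k 0 t<k) (trans (sym ws) eq)
  ... | e = 1≢k-1 k k≥3 e
    where
    1≢k-1 : ∀ k → 3 ≤ k → 1 ≢ k ∸ 1
    1≢k-1 (suc (suc (suc k))) _ ()
    1≢k-1 (suc (suc zero)) (s≤s (s≤s ())) _
  nbr-distinct (suc t) t<k eq | s' , s'<k , ws , inj₁ refl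
    with inj (suc (suc t)) t s'<k (<-trans (n<1+n t) t<k) (trans (sym ws) eq)
  ... | ()
  nbr-distinct t t<k eq | s' , s'<k , ws , inj₂ (sk , refl)
    with inj 0 (prev t) k≥1 (prev<k t t<k) (trans (sym ws) eq)
  nbr-distinct zero t<k eq | s' , s'<k , ws , inj₂ (sk , refl) | e = 1≢k k k≥3 sk
    where
    1≢k : ∀ k → 3 ≤ k → 1 ≢ k
    1≢k (suc (suc (suc k))) _ ()
    1≢k (suc zero) (s≤s ()) _
  nbr-distinct (suc t) t<k eq | s' , s'<k , ws , inj₂ (sk , refl) | refl = 2≢k k k≥3 sk
    where
    2≢k : ∀ k → 3 ≤ k → 2 ≢ k
    2≢k (suc (suc (suc k))) _ ()
    2≢k (suc (suc zero)) (s≤s (s≤s ())) _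

module CycleFacts {n} {R : Rel n} (symR : Symm R) (C : Cycle R) where
  open Cycle C
  open CycleIndexing k w k≥3 wrap inj public

  nbr : ∀ t → t < k → ∀ y → R (w t) y ≡ true → y ≡ w (suc t) ⊎ y ≡ w (prev t)
  nbr t t<k y e with edges→ (w t) y e
  ... | s , s<k , inj₁ (e1 , e2) rewrite inj t s t<k s<k e1 = inj₁ e2
  ... | s , s<k , inj₂ (e1 , e2) with norm (suc s) s<k
  ... | s' , s'<k , ws , inj₁ refl rewrite inj t (suc s) t<k s'<k (trans e1 ws) = inj₂ e2
  ... | s' , s'<k , ws , inj₂ (sk , refl) with inj t 0 t<k k≥1 (trans e1 ws)
  ... | refl = inj₂ (trans e2 (cong w (s≡k-1 sk)))
    where
    s≡k-1 : suc s ≡ k → s ≡ k ∸ 1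
    s≡k-1 refl = refl

  onCycle : ∀ x → Supp R x → Σ ℕ λ t → t < k × x ≡ w t
  onCycle x (y , e) with edges→ x y e
  ... | t , t<k , inj₁ (e1 , _) = t , t<k , e1
  ... | t , t<k , inj₂ (e1 , _) with norm (suc t) t<k
  ... | s' , s'<k , ws , _ = s' , s'<k , trans e1 ws

  deg2 : ∀ x y → R x y ≡ true → countᶠ (R x) ≡ 2
  deg2 x y e with onCycle x (y , e)
  ... | t , t<k , refl =
    count-two (R (w t)) (w (suc t)) (w (prev t)) (nbr-distinct t t<k) (nbr t t<k) (→edges t t<k)
      (trans (symR (w t) (w (prev t)))
        (subst (λ z → R (w (prev t)) z ≡ true) (w-prev t) (→edges (prev t) (prev<k t t<k))))

  reach-up : ∀ a d → a + d ≤ k → RReach R (w a) (w (a + d))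
  reach-up a zero _ rewrite +-identityʳ a = here
  reach-up a (suc d) a+1+d≤k rewrite +-suc a d =
    step (→edges a (≤-trans (s≤s (m≤m+n a d)) a+1+d≤k)) (reach-up (suc a) d a+1+d≤k)

  -- Walk forward from a to b, passing through w k = w 0 if b < a.
  reach-idx : ∀ a b → a < k → b < k → RReach R (w a) (w b)
  reach-idx a b a<k b<k with ≤-total a b
  ... | inj₁ a≤b = subst (λ z → RReach R (w a) (w z)) (m+[n∸m]≡n a≤b)
                     (reach-up a (b ∸ a) (subst (_≤ k) (sym (m+[n∸m]≡n a≤b)) (<⇒≤ b<k)))
  ... | inj₂ b≤a = reach-trans toWrap (reach-up 0 b (<⇒≤ b<k))
    where
    toWrap : RReach R (w a) (w 0)
    toWrap = subst (RReach R (w a)) wrap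
               (subst (λ z → RReach R (w a) (w z)) (m+[n∸m]≡n (<⇒≤ a<k))
                 (reach-up a (k ∸ a) (subst (_≤ k) (sym (m+[n∸m]≡n (<⇒≤ a<k))) ≤-refl)))

  conn : ∀ x y → Supp R x → Supp R y → RReach R x y
  conn x y sx sy with onCycle x sx | onCycle y sy
  ... | a , a<k , refl | b , b<k , refl = reach-idx a b a<k b<k

  onCycleB : Fin n → Bool
  onCycleB b = anyBelow k (λ t → eqB (w t) b)

  count-onCycle : ∀ k' → k' ≤ k → countᶠ (λ b → anyBelow k' (λ t → eqB (w t) b)) ≡ k'
  count-onCycle zero _ = count-0 {n} _ (λ _ → refl)
  count-onCycle (suc k') k'<k =
    trans (count-add _ _ (w k') new (λ x → cong (anyBelow k' (λ t → eqB (w t) x) ∨_) (eqB-sym (w k') x)))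
          (cong suc (count-onCycle k' (<⇒≤ k'<k)))
    where
    new : anyBelow k' (λ t → eqB (w t) (w k')) ≡ false
    new = anyBelow-false k' _ (λ t t<k' → eqB-≢ (λ e → <⇒≢ t<k' (inj t k' (<-trans t<k' k'<k) k'<k e)))

  total : sumᶠ (λ b → countᶠ (R b)) ≡ 2 * k
  total = trans (sumᶠ-ext _ _ degree)
            (trans (sumᶠ-2* (λ b → if onCycleB b then 1 else 0)) (cong (2 *_) (count-onCycle k ≤-refl)))
    where
    degree : ∀ b → countᶠ (R b) ≡ 2 * (if onCycleB b then 1 else 0)
    degree b with onCycleB b in onB
    ... | true with anyBelow-true k _ onB
    ... | t , t<k , e = subst (λ z → countᶠ (R z) ≡ 2) (eqB-true e) (deg2 (w t) (w (suc t)) (→edges t t<k))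
    degree b | false = count-0 _ isolated
      where
      isolated : ∀ c → R b c ≡ false
      isolated c with R b c in e
      ... | false = refl
      ... | true with onCycle b (c , e)
      ... | t , t<k , refl = ⊥-elim (true≢false (trans (sym (anyBelow-intro k _ t t<k (eqB-refl (w t)))) onB))

-- Two cycles of the same relation have the same length (their total degrees agree).
cycle-length-unique : ∀ {n} {R : Rel n} → Symm R → (C C' : Cycle R) → Cycle.k C ≡ Cycle.k C'
cycle-length-unique symR C C' =
  *-cancelˡ-≡ (Cycle.k C) (Cycle.k C') 2 (trans (sym (CycleFacts.total symR C)) (CycleFacts.total symR C'))

count3-lengths : ∀ {M} (R : Fin M → Fin M → Fin M → Bool) (symR : ∀ a → Symm (R a))
  (C : ∀ a → Cycle (R a)) → count3 R ≡ 2 * sumᶠ (λ a → Cycle.k (C a))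
count3-lengths R symR C =
  trans (sumᶠ-ext _ _ (λ a → CycleFacts.total (symR a) (C a))) (sumᶠ-2* (λ a → Cycle.k (C a)))

excess : ∀ k → 3 ≤ k → Σ ℕ λ ℓ → k ≡ 3 + ℓ
excess (suc (suc (suc ℓ))) _ = ℓ , refl
excess (suc zero) (s≤s ())
excess (suc (suc zero)) (s≤s (s≤s ()))

module CycleEnds {n} {R : Rel n} (C : Cycle R) where
  open Cycle C public

  is0 : ∀ t → t < k → w t ≡ w 0 → t ≡ 0
  is0 t t<k e = inj t 0 t<k (≤-trans (s≤s z≤n) k≥3) e

  isK : ∀ s → s < k → w (suc s) ≡ w 0 → suc s ≡ k
  isK s s<k e with m≤n⇒m<n∨m≡n s<k
  ... | inj₁ 1+s<k with inj (suc s) 0 1+s<k (≤-trans (s≤s z≤n) k≥3) e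
  ...   | ()
  isK s s<k e | inj₂ 1+s≡k = 1+s≡k

  interior : ∀ s y z → s < k → EdgeAt w s y z → y ≢ w 0 → z ≢ w 0 →
    Σ ℕ λ s' → s ≡ suc s' × suc (suc s') < k
  interior zero y z _ (inj₁ (e1 , _)) y≢w0 z≢w0 = ⊥-elim (y≢w0 e1)
  interior zero y z _ (inj₂ (_ , e2)) y≢w0 z≢w0 = ⊥-elim (z≢w0 e2)
  interior (suc s') y z s<k edge y≢w0 z≢w0 with m≤n⇒m<n∨m≡n s<k
  ... | inj₁ lt = s' , refl , lt
  ... | inj₂ eq = ⊥-elim (atEnd edge)
    where
    wk : w (suc (suc s')) ≡ w 0
    wk = trans (cong w eq) wrap
    atEnd : EdgeAt w (suc s') y z → ⊥
    atEnd (inj₁ (_ , e2)) = z≢w0 (trans e2 wk)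
    atEnd (inj₂ (e1 , _)) = y≢w0 (trans e1 wk)

-- The cycle is traced from a given edge v0 v1 by always stepping to the
-- neighbour we did not come from; the first repetition closes the cycle.
module TraceCycle {n} {R : Rel n} (symR : Symm R) (irr : ∀ x → R x x ≡ false)
  (deg : ∀ x y → R x y ≡ true → countᶠ (R x) ≡ 2)
  (connR : ∀ x y → Supp R x → Supp R y → RReach R x y)
  (v0 v1 : Fin n) (e01 : R v0 v1 ≡ true) where

  two-nbrs : ∀ x u v c → R x u ≡ true → R x v ≡ true → u ≢ v → R x c ≡ true → c ≡ u ⊎ c ≡ v
  two-nbrs x u v c xu xv u≢v xc = count≡2-only (R x) (deg x u xu) xu xv u≢v xc

  other : Fin n → Fin n → Fin n
  other x y = pick (λ z → R x z ∧ not (eqB z y)) y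

  other-spec : ∀ x y → R x y ≡ true → R x (other x y) ≡ true × other x y ≢ y
  other-spec x y e with ∧-not-true {R x (other x y)} {eqB (other x y) y}
                          (pick-spec (λ z → R x z ∧ not (eqB z y)) y exists)
    where
    exists : Σ (Fin n) λ z → (R x z ∧ not (eqB z y)) ≡ true
    exists with count≡2⇒pair (R x) (deg x y e)
    ... | a , b , a≢b , pa , pb , _ with a ≟ᶠ y
    ... | yes refl = b , ∧-not-intro pb (eqB-≢ (λ e → a≢b (sym e)))
    ... | no a≢y = a , ∧-not-intro pa (eqB-≢ a≢y)
  ... | adjacent , differs = adjacent , λ e → true≢false (trans (sym (trans (cong (λ z → eqB z y) e) (eqB-refl y))) differs)

  walk : ℕ → Fin n
  walk zero = v0
  walk (suc zero) = v1
  walk (suc (suc t)) = other (walk (suc t)) (walk t)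

  walk-edge : ∀ t → R (walk t) (walk (suc t)) ≡ true
  walk-edge zero = e01
  walk-edge (suc t) = proj₁ (other-spec (walk (suc t)) (walk t) (trans (symR _ _) (walk-edge t)))

  no-backtrack : ∀ t → walk (suc (suc t)) ≢ walk t
  no-backtrack t = proj₂ (other-spec (walk (suc t)) (walk t) (trans (symR _ _) (walk-edge t)))

  no-loop : ∀ t → walk (suc t) ≢ walk t
  no-loop t e = true≢false (trans (sym (walk-edge t)) (trans (cong (R (walk t)) e) (irr (walk t))))

  walk-nbrs : ∀ p c → R (walk (suc p)) c ≡ true → c ≡ walk p ⊎ c ≡ walk (suc (suc p))
  walk-nbrs p c e = two-nbrs (walk (suc p)) (walk p) (walk (suc (suc p))) c
    (trans (symR _ _) (walk-edge p)) (walk-edge (suc p)) (λ q → no-backtrack p (sym q)) e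

  -- "walk q repeats an earlier vertex"; by pigeonhole this happens, and k is
  -- the least such q.
  repeats : ℕ → Bool
  repeats q = anyBelow q (λ p → eqB (walk p) (walk q))

  some-repeat : Σ ℕ λ q → repeats q ≡ true
  some-repeat with pigeonhole ≤-refl (λ (x : Fin (suc n)) → walk (toℕ x))
  ... | a , b , a<b , e = toℕ b , anyBelow-intro (toℕ b) _ (toℕ a) a<b
                                    (subst (λ z → eqB (walk (toℕ a)) z ≡ true) e (eqB-refl (walk (toℕ a))))

  first-repeat : Σ ℕ λ q → repeats q ≡ true × (∀ q' → q' < q → repeats q' ≡ false)
  first-repeat = minimise repeats (proj₁ some-repeat) (proj₂ some-repeat)

  k : ℕ
  k = proj₁ first-repeat

  k-repeats : repeats k ≡ true
  k-repeats = proj₁ (proj₂ first-repeat)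

  no-earlier-repeat : ∀ p q → p < q → q < k → walk p ≢ walk q
  no-earlier-repeat p q p<q q<k e =
    true≢false (trans (sym (anyBelow-intro q _ p p<q (subst (λ z → eqB (walk p) z ≡ true) e (eqB-refl (walk p)))))
                      (proj₂ (proj₂ first-repeat) q q<k))

  -- The repetition at k returns to the start: a return to walk (p+1) with
  -- p+1 < k would give walk p or walk (p+2) a second occurrence before k.
  wrap0 : walk k ≡ walk 0
  wrap0 with anyBelow-true k _ k-repeats
  ... | zero , _ , e = sym (eqB-true e)
  ... | suc p' , 1+p'<k , e = ⊥-elim (noReturn k refl 1+p'<k (eqB-true e))
    where
    noReturn : ∀ q → q ≡ k → suc p' < q → walk (suc p') ≡ walk q → ⊥
    noReturn (suc q'') qk p'<q'' e
      with walk-nbrs p' (walk q'') (trans (symR _ _) (subst (λ z → R (walk q'') z ≡ true) (sym e) (walk-edge q'')))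
    ... | inj₁ e1 = no-earlier-repeat p' q'' (≤-pred p'<q'') (subst (q'' <_) qk ≤-refl) (sym e1)
    ... | inj₂ e2 with <-cmp (suc (suc p')) q''
    ... | tri< lt _ _ = no-earlier-repeat (suc (suc p')) q'' lt (subst (q'' <_) qk ≤-refl) (sym e2)
    ... | tri≈ _ refl _ = no-backtrack (suc p') (sym e)
    ... | tri> _ _ gt with m≤n⇒m<n∨m≡n (≤-pred p'<q'')
    ... | inj₁ lt = ⊥-elim (<-irrefl refl (≤-trans gt lt))
    ... | inj₂ refl = no-loop (suc p') (sym e)

  -- no loops and no backtracking make the cycle have length at least 3
  k≥3 : 3 ≤ k
  k≥3 with anyBelow-true k _ k-repeats
  ... | p , p<k , e = atLeast3 k p<k (eqB-true e)
    where
    atLeast3 : ∀ q → p < q → walk p ≡ walk q → 3 ≤ q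
    atLeast3 (suc (suc (suc q))) _ _ = s≤s (s≤s (s≤s z≤n))
    atLeast3 (suc zero) (s≤s z≤n) e = ⊥-elim (no-loop 0 (sym e))
    atLeast3 (suc (suc zero)) (s≤s z≤n) e = ⊥-elim (no-backtrack 0 (sym e))
    atLeast3 (suc (suc zero)) (s≤s (s≤s z≤n)) e = ⊥-elim (no-loop 1 (sym e))

  walk-inj : ∀ a b → a < k → b < k → walk a ≡ walk b → a ≡ b
  walk-inj a b a<k b<k e with <-cmp a b
  ... | tri< a<b _ _ = ⊥-elim (no-earlier-repeat a b a<b b<k e)
  ... | tri≈ _ a≡b _ = a≡b
  ... | tri> _ _ b<a = ⊥-elim (no-earlier-repeat b a b<a a<k (sym e))

  open CycleIndexing k walk k≥3 wrap0 walk-inj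

  nbrs : ∀ t → t < k → ∀ c → R (walk t) c ≡ true → c ≡ walk (suc t) ⊎ c ≡ walk (prev t)
  nbrs t t<k c e = two-nbrs (walk t) (walk (suc t)) (walk (prev t)) c (walk-edge t)
    (trans (symR _ _) (subst (λ z → R (walk (prev t)) z ≡ true) (w-prev t) (walk-edge (prev t))))
    (nbr-distinct t t<k) e

  closed : ∀ t → t < k → ∀ c → R (walk t) c ≡ true → Σ ℕ λ t' → t' < k × c ≡ walk t'
  closed t t<k c e with nbrs t t<k c e
  ... | inj₂ e2 = prev t , prev<k t t<k , e2
  ... | inj₁ e1 with norm (suc t) t<k
  ... | s' , s'<k , ws , _ = s' , s'<k , trans e1 ws

  -- by connectivity every non-isolated point lies on the traced cycle
  onWalk : ∀ x → RReach R v0 x → Σ ℕ λ t → t < k × x ≡ walk t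
  onWalk x r = go v0 x r (0 , k≥1 , refl)
    where
    go : ∀ a x → RReach R a x → Σ ℕ (λ t → t < k × a ≡ walk t) → Σ ℕ λ t → t < k × x ≡ walk t
    go a .a here h = h
    go a x (step {y = y} e r) (t , t<k , refl) = go y x r (closed t t<k y e)

  walk-edges : ∀ x y → R x y ≡ true → Σ ℕ λ t → t < k × EdgeAt walk t x y
  walk-edges x y e with onWalk x (connR v0 x (v1 , e01) (y , e))
  ... | t , t<k , refl with nbrs t t<k y e
  ... | inj₁ e1 = t , t<k , inj₁ (refl , e1)
  ... | inj₂ e2 = prev t , prev<k t t<k , inj₂ (sym (w-prev t) , e2)

  cycle : Cycle R
  cycle = record { k = k ; w = walk ; k≥3 = k≥3 ; wrap = wrap0 ; inj = walk-inj
                 ; edges→ = walk-edges ; →edges = λ t _ → walk-edge t }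

opaque
  cycle-through : ∀ {n} {R : Rel n} → Symm R → (∀ x → R x x ≡ false) →
    (∀ x y → R x y ≡ true → countᶠ (R x) ≡ 2) →
    (∀ x y → Supp R x → Supp R y → RReach R x y) →
    ∀ v0 v1 → R v0 v1 ≡ true → Σ (Cycle R) λ C → Cycle.w C 0 ≡ v0 × Cycle.w C 1 ≡ v1
  cycle-through symR irr deg connR v0 v1 e = TraceCycle.cycle symR irr deg connR v0 v1 e , refl , refl

module Polytope (P : SimplePolytope) where
  N : ℕ
  N = n P
  T : Fin N → Fin N → Fin N → Bool
  T = tri P
  open IsSimple3Polytope (isSimple P) public

  P213 : ∀ {a b c} → T a b c ≡ true → T b a c ≡ true
  P213 {a} {b} {c} e = trans (sym (sym₁ a b c)) e
  P132 : ∀ {a b c} → T a b c ≡ true → T a c b ≡ true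
  P132 {a} {b} {c} e = trans (sym (sym₂ a b c)) e
  P231 : ∀ {a b c} → T a b c ≡ true → T b c a ≡ true
  P231 e = P132 (P213 e)
  P312 : ∀ {a b c} → T a b c ≡ true → T c a b ≡ true
  P312 e = P213 (P132 e)
  P321 : ∀ {a b c} → T a b c ≡ true → T c b a ≡ true
  P321 e = P213 (P132 (P213 e))

  F12 : ∀ a c → T a a c ≡ false
  F12 = irrefl
  F23 : ∀ a b → T a b b ≡ false
  F23 a b = trans (sym₁ a b b) (trans (sym₂ b a b) (irrefl b a))
  F13 : ∀ a b → T a b a ≡ false
  F13 a b = trans (sym₂ a b a) (irrefl a b)

  t≢ : ∀ {a b c} → T a b c ≡ true → a ≢ b × b ≢ c × a ≢ c
  t≢ {a} {b} {c} e = (λ { refl → true≢false (trans (sym e) (F12 a c)) }) ,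
                     (λ { refl → true≢false (trans (sym e) (F23 a b)) }) ,
                     (λ { refl → true≢false (trans (sym e) (F13 a b)) })

  linkCycle : ∀ a v0 v1 → T a v0 v1 ≡ true → Σ (Cycle (T a)) λ C → Cycle.w C 0 ≡ v0 × Cycle.w C 1 ≡ v1
  linkCycle a = cycle-through (sym₂ a) (F23 a) (λ x y e → edge2 a x (y , e)) (linkConn a)

  module LinkCycle (x : Fin N) (C : Cycle (T x)) where
    open CycleEnds C public

    adj : ∀ t → t < k → AdjT T x (w t)
    adj t t<k = w (suc t) , →edges t t<k

    w≢x : ∀ t → t < k → w t ≢ x
    w≢x t t<k e = proj₁ (t≢ (→edges t t<k)) (sym e)

  third : ∀ a b c d e → T a b c ≡ true → T a b d ≡ true → c ≢ d → T a b e ≡ true → e ≡ c ⊎ e ≡ d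
  third a b c d e tc td c≢d te = count≡2-only (T a b) (edge2 a b (c , tc)) tc td c≢d te

  -- If the link of x contains a triangle p q r, then x is a triangle whose
  -- only neighbours are p, q, r (the link is connected and closed under
  -- the "third vertex" map).
  closeLink : ∀ x p q r → T x p q ≡ true → T x q r ≡ true → T x p r ≡ true →
    ∀ y → AdjT T x y → y ≡ p ⊎ y ≡ q ⊎ y ≡ r
  closeLink x p q r pq qr pr y adj = go p y (linkConn x p y (q , pq) adj) (inj₁ refl)
    where
    In3 : Fin N → Set
    In3 z = z ≡ p ⊎ z ≡ q ⊎ z ≡ r
    stp : ∀ z z' → T x z z' ≡ true → In3 z → In3 z'
    stp z z' e (inj₁ refl) with third x p q r z' pq pr (proj₁ (proj₂ (t≢ qr))) e
    ... | inj₁ h = inj₂ (inj₁ h)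
    ... | inj₂ h = inj₂ (inj₂ h)
    stp z z' e (inj₂ (inj₁ refl)) with third x q p r z' (P132 pq) qr (proj₁ (proj₂ (t≢ pr))) e
    ... | inj₁ h = inj₁ h
    ... | inj₂ h = inj₂ (inj₂ h)
    stp z z' e (inj₂ (inj₂ refl)) with third x r p q z' (P132 pr) (P132 qr) (proj₁ (proj₂ (t≢ pq))) e
    ... | inj₁ h = inj₁ h
    ... | inj₂ h = inj₂ (inj₁ h)
    go : ∀ z y → RReach (T x) z y → In3 z → In3 y
    go z .z here h = h
    go z y (step {y = z'} e r) h = go z' y r (stp z z' e h)

  -- Every facet has at least two neighbours besides the facet it meets in an
  -- edge, so every polytope has at least four facets.
  atLeastFourFacets : Fin N → 4 ≤ N
  atLeastFourFacets a with nonempty a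
  ... | b , c , tabc with count≡2⇒pair (T a b) (edge2 a b (c , tabc))
  ... | u , v , u≢v , tu , tv , _ =
    distinct4⇒4≤ a b u v (proj₁ (t≢ tu)) (proj₂ (proj₂ (t≢ tu))) (proj₂ (proj₂ (t≢ tv)))
      (proj₁ (proj₂ (t≢ tu))) (proj₁ (proj₂ (t≢ tv))) u≢v

  module RecogniseTetrahedron (a b c d : Fin N) (Tabc : T a b c ≡ true) (Tabd : T a b d ≡ true)
             (Tacd : T a c d ≡ true) (Tbcd : T b c d ≡ true) where
    a≢b : a ≢ b
    a≢b = proj₁ (t≢ Tabc)
    b≢c : b ≢ c
    b≢c = proj₁ (proj₂ (t≢ Tabc))
    a≢c : a ≢ c
    a≢c = proj₂ (proj₂ (t≢ Tabc))
    b≢d : b ≢ d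
    b≢d = proj₁ (proj₂ (t≢ Tabd))
    a≢d : a ≢ d
    a≢d = proj₂ (proj₂ (t≢ Tabd))
    c≢d : c ≢ d
    c≢d = proj₁ (proj₂ (t≢ Tacd))

    Corner : Fin N → Set
    Corner x = x ≡ a ⊎ x ≡ b ⊎ x ≡ c ⊎ x ≡ d

    -- each of a, b, c, d is a triangle whose neighbours are the other three
    adjCorner : ∀ x y → Corner x → AdjT T x y → Corner y
    adjCorner x y (inj₁ refl) adj with closeLink a b c d Tabc Tacd Tabd y adj
    ... | inj₁ h = inj₂ (inj₁ h)
    ... | inj₂ (inj₁ h) = inj₂ (inj₂ (inj₁ h))
    ... | inj₂ (inj₂ h) = inj₂ (inj₂ (inj₂ h))
    adjCorner x y (inj₂ (inj₁ refl)) adj with closeLink b a c d (P213 Tabc) Tbcd (P213 Tabd) y adj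
    ... | inj₁ h = inj₁ h
    ... | inj₂ (inj₁ h) = inj₂ (inj₂ (inj₁ h))
    ... | inj₂ (inj₂ h) = inj₂ (inj₂ (inj₂ h))
    adjCorner x y (inj₂ (inj₂ (inj₁ refl))) adj with closeLink c a b d (P312 Tabc) (P213 Tbcd) (P213 Tacd) y adj
    ... | inj₁ h = inj₁ h
    ... | inj₂ (inj₁ h) = inj₂ (inj₁ h)
    ... | inj₂ (inj₂ h) = inj₂ (inj₂ (inj₂ h))
    adjCorner x y (inj₂ (inj₂ (inj₂ refl))) adj with closeLink d a b c (P312 Tabd) (P312 Tbcd) (P312 Tacd) y adj
    ... | inj₁ h = inj₁ h
    ... | inj₂ (inj₁ h) = inj₂ (inj₁ h)
    ... | inj₂ (inj₂ h) = inj₂ (inj₂ (inj₁ h))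

    -- by connectivity of the facet graph there are no other facets
    allCorners : ∀ x → Corner x
    allCorners x = go a x (connected a x) (inj₁ refl)
      where
      go : ∀ z y → Reach (AdjT T) z y → Corner z → Corner y
      go z .z here h = h
      go z y (step {y = z'} e r) h = go z' y r (adjCorner z z' h e)

    corner : Fin 4 → Fin N
    corner 0F = a
    corner 1F = b
    corner 2F = c
    corner 3F = d

    label : Fin N → Fin 4
    label x with x ≟ᶠ a
    ... | yes _ = 0F
    ... | no _ with x ≟ᶠ b
    ... | yes _ = 1F
    ... | no _ with x ≟ᶠ c
    ... | yes _ = 2F
    ... | no _ = 3F

    label-corner : ∀ p → label (corner p) ≡ p
    label-corner 0F with a ≟ᶠ a
    ... | yes _ = refl
    ... | no a≢a = ⊥-elim (a≢a refl)
    label-corner 1F with b ≟ᶠ a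
    ... | yes b≡a = ⊥-elim (a≢b (sym b≡a))
    ... | no _ with b ≟ᶠ b
    ... | yes _ = refl
    ... | no b≢b = ⊥-elim (b≢b refl)
    label-corner 2F with c ≟ᶠ a
    ... | yes c≡a = ⊥-elim (a≢c (sym c≡a))
    ... | no _ with c ≟ᶠ b
    ... | yes c≡b = ⊥-elim (b≢c (sym c≡b))
    ... | no _ with c ≟ᶠ c
    ... | yes _ = refl
    ... | no c≢c = ⊥-elim (c≢c refl)
    label-corner 3F with d ≟ᶠ a
    ... | yes d≡a = ⊥-elim (a≢d (sym d≡a))
    ... | no _ with d ≟ᶠ b
    ... | yes d≡b = ⊥-elim (b≢d (sym d≡b))
    ... | no _ with d ≟ᶠ c
    ... | yes d≡c = ⊥-elim (c≢d (sym d≡c))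
    ... | no _ = refl

    corner-label : ∀ x → corner (label x) ≡ x
    corner-label x with allCorners x
    ... | inj₁ refl rewrite label-corner 0F = refl
    ... | inj₂ (inj₁ refl) rewrite label-corner 1F = refl
    ... | inj₂ (inj₂ (inj₁ refl)) rewrite label-corner 2F = refl
    ... | inj₂ (inj₂ (inj₂ refl)) rewrite label-corner 3F = refl

    row-a : ∀ q r → T a (corner q) (corner r) ≡ distinct3 0F q r
    row-a 0F 0F = F12 a a
    row-a 0F 1F = F12 a b
    row-a 0F 2F = F12 a c
    row-a 0F 3F = F12 a d
    row-a 1F 0F = F13 a b
    row-a 1F 1F = F23 a b
    row-a 1F 2F = Tabc
    row-a 1F 3F = Tabd
    row-a 2F 0F = F13 a c
    row-a 2F 1F = P132 Tabc
    row-a 2F 2F = F23 a c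
    row-a 2F 3F = Tacd
    row-a 3F 0F = F13 a d
    row-a 3F 1F = P132 Tabd
    row-a 3F 2F = P132 Tacd
    row-a 3F 3F = F23 a d

    row-b : ∀ q r → T b (corner q) (corner r) ≡ distinct3 1F q r
    row-b 0F 0F = F23 b a
    row-b 0F 1F = F13 b a
    row-b 0F 2F = P213 Tabc
    row-b 0F 3F = P213 Tabd
    row-b 1F 0F = F12 b a
    row-b 1F 1F = F12 b b
    row-b 1F 2F = F12 b c
    row-b 1F 3F = F12 b d
    row-b 2F 0F = P231 Tabc
    row-b 2F 1F = F13 b c
    row-b 2F 2F = F23 b c
    row-b 2F 3F = Tbcd
    row-b 3F 0F = P231 Tabd
    row-b 3F 1F = F13 b d
    row-b 3F 2F = P132 Tbcd
    row-b 3F 3F = F23 b d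

    row-c : ∀ q r → T c (corner q) (corner r) ≡ distinct3 2F q r
    row-c 0F 0F = F23 c a
    row-c 0F 1F = P312 Tabc
    row-c 0F 2F = F13 c a
    row-c 0F 3F = P213 Tacd
    row-c 1F 0F = P321 Tabc
    row-c 1F 1F = F23 c b
    row-c 1F 2F = F13 c b
    row-c 1F 3F = P213 Tbcd
    row-c 2F 0F = F12 c a
    row-c 2F 1F = F12 c b
    row-c 2F 2F = F12 c c
    row-c 2F 3F = F12 c d
    row-c 3F 0F = P231 Tacd
    row-c 3F 1F = P231 Tbcd
    row-c 3F 2F = F13 c d
    row-c 3F 3F = F23 c d

    row-d : ∀ q r → T d (corner q) (corner r) ≡ distinct3 3F q r
    row-d 0F 0F = F23 d a
    row-d 0F 1F = P312 Tabd
    row-d 0F 2F = P312 Tacd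
    row-d 0F 3F = F13 d a
    row-d 1F 0F = P321 Tabd
    row-d 1F 1F = F23 d b
    row-d 1F 2F = P312 Tbcd
    row-d 1F 3F = F13 d b
    row-d 2F 0F = P321 Tacd
    row-d 2F 1F = P321 Tbcd
    row-d 2F 2F = F23 d c
    row-d 2F 3F = F13 d c
    row-d 3F 0F = F12 d a
    row-d 3F 1F = F12 d b
    row-d 3F 2F = F12 d c
    row-d 3F 3F = F12 d d
    table : ∀ p q r → T (corner p) (corner q) (corner r) ≡ distinct3 p q r
    table 0F = row-a
    table 1F = row-b
    table 2F = row-c
    table 3F = row-d

    isTetrahedron : IsTetrahedron P
    isTetrahedron = mk↔ₛ′ label corner label-corner corner-label , vertices
      where
      vertices : ∀ x y z → T x y z ≡ distinct3 (label x) (label y) (label z)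
      vertices x y z = trans (cong₃ T (sym (corner-label x)) (sym (corner-label y)) (sym (corner-label z)))
                             (table (label x) (label y) (label z))

decAdj : ∀ {N} (T : Fin N → Fin N → Fin N → Bool) a b → Dec (AdjT T a b)
decAdj T a b with search (T a b)
... | inj₁ found = yes found
... | inj₂ none = no (λ { (c , e) → true≢false (trans (sym e) (none c)) })

next-val : ∀ {K} (t : Fin K) →
  (suc (toℕ t) < K × toℕ (next t) ≡ suc (toℕ t)) ⊎ (suc (toℕ t) ≡ K × toℕ (next t) ≡ 0)
next-val {suc K} t with m≤n⇒m<n∨m≡n (toℕ<n t)
... | inj₁ lt = inj₁ (lt , trans (toℕ-fromℕ< _) (m<n⇒m%n≡m lt))
... | inj₂ e = inj₂ (e , trans (toℕ-fromℕ< _) (trans (cong (_% suc K) e) (n%n≡0 (suc K))))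

at-next : ∀ {K} {X : Set} (f : ℕ → X) → f K ≡ f 0 → (t : Fin K) → f (toℕ (next t)) ≡ f (suc (toℕ t))
at-next f wrap t with next-val t
... | inj₁ (_ , e) = cong f e
... | inj₂ (e1 , e2) = trans (cong f e2) (trans (sym wrap) (cong f (sym e1)))

-- A truncation adds exactly one facet; we only need that it adds at least one:
-- j together with a section of φ avoiding j embeds Fin (1 + n Q) into Fin (n P).
truncation-adds-facet : ∀ {P Q i j} → Truncation P Q i j → n Q < n P
truncation-adds-facet {P} {Q} {i} {j} tr = injective⇒≤ {f = embed} embed-inj
  where
  open Truncation tr

  section : Fin (n Q) → Fin (n P)
  section z with proj₁ (φ-sur z) ≟ᶠ j
  ... | yes _ = i
  ... | no _ = proj₁ (φ-sur z)

  φ-section : ∀ z → φ (section z) ≡ z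
  φ-section z with proj₁ (φ-sur z) ≟ᶠ j
  ... | yes e = trans φi (trans (sym φj) (trans (cong φ (sym e)) (proj₂ (φ-sur z))))
  ... | no _ = proj₂ (φ-sur z)

  section≢j : ∀ z → section z ≢ j
  section≢j z with proj₁ (φ-sur z) ≟ᶠ j
  ... | yes _ = i≢j
  ... | no ne = ne

  embed : Fin (suc (n Q)) → Fin (n P)
  embed 0F = j
  embed (fsuc z) = section z

  embed-inj : ∀ {x y} → embed x ≡ embed y → x ≡ y
  embed-inj {0F} {0F} e = refl
  embed-inj {0F} {fsuc y} e = ⊥-elim (section≢j y (sym e))
  embed-inj {fsuc x} {0F} e = ⊥-elim (section≢j x e)
  embed-inj {fsuc x} {fsuc y} e = cong fsuc (trans (sym (φ-section x)) (trans (cong φ e) (φ-section y)))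

tetrahedron-size : ∀ P → IsTetrahedron P → n P ≤ 4
tetrahedron-size P (σ , _) = injective⇒≤ {f = Inverse.to σ} (Injection.injective (↔⇒↣ σ))

-- First half of the theorem: a straightening of Δ³ would have fewer than four facets.
tetrahedron-no-straightening : (P : SimplePolytope) → IsTetrahedron P →
  ∀ i j → IsEdge P i j → ¬ StraighteningDefined P i j
tetrahedron-no-straightening P tet i j _ (Q , tr) =
  <-irrefl refl (≤-trans (s≤s (Polytope.atLeastFourFacets Q (facet tr)))
                         (≤-trans (fewer tr) (tetrahedron-size P tet)))
  where
  facet : Truncation P Q i j ⊎ Truncation P Q j i → Fin (n Q)
  facet (inj₁ t) = Truncation.F t
  facet (inj₂ t) = Truncation.F t
  fewer : Truncation P Q i j ⊎ Truncation P Q j i → n Q < n P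
  fewer (inj₁ t) = truncation-adds-facet t
  fewer (inj₂ t) = truncation-adds-facet t

-- A common neighbour F_k of the halves F_i = F' and F_j = F'' of a truncated
-- facet F is a neighbour of F along an edge E_a with a ≤ s+1 (seen from F')
-- and along an edge E_b with b > s or b = 0 (seen from F''). As F's
-- neighbours are distinct, a = b ∈ {0, s+1}, so F_k contains an endpoint of
-- the new edge and (F_i, F_j, F_k) is not a 3-belt.
truncation-edge-in-no-belt : ∀ (P Q : SimplePolytope) i j → Truncation P Q i j → ∀ k → ¬ Belt3 P i j k
truncation-edge-in-no-belt P Q i j tr kk (_ , (d , tjk) , (c , tik) , ijk-no-vertex) =
  no-such-k
  where
  open Truncation tr
  open Polytope P
  k≢j : kk ≢ j
  k≢j e = proj₁ (t≢ tjk) (sym e)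
  k≢i : kk ≢ i
  k≢i e = proj₁ (t≢ tik) (sym e)
  c≢i : c ≢ i
  c≢i e = proj₂ (proj₂ (t≢ tik)) (sym e)
  c≢j : c ≢ j
  c≢j refl = true≢false (trans (sym tik) (trans (sym₂ i kk j) ijk-no-vertex))
  d≢j : d ≢ j
  d≢j e = proj₂ (proj₂ (t≢ tjk)) (sym e)
  d≢i : d ≢ i
  d≢i refl = true≢false (trans (sym tjk) (trans (sym₂ j kk i) (trans (sym₁ j i kk) ijk-no-vertex)))

  onF' : Σ (Fin k) λ a → toℕ a ≤ suc s × φ kk ≡ g a
  onF' with Equivalence.to (F'V kk c k≢i k≢j c≢i c≢j) tik
  ... | t , t≤s , inj₁ (e1 , _) = t , m≤n⇒m≤1+n t≤s , e1
  ... | t , t≤s , inj₂ (e1 , _) with next-val t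
  ... | inj₁ (_ , nv) = next t , subst (_≤ suc s) (sym nv) (s≤s t≤s) , e1
  ... | inj₂ (_ , nv) = next t , subst (_≤ suc s) (sym nv) z≤n , e1

  onF'' : Σ (Fin k) λ b → (s < toℕ b ⊎ toℕ b ≡ 0) × φ kk ≡ g b
  onF'' with Equivalence.to (F''V kk d k≢i k≢j d≢i d≢j) tjk
  ... | t , s<t , inj₁ (e1 , _) = t , inj₁ s<t , e1
  ... | t , s<t , inj₂ (e1 , _) with next-val t
  ... | inj₁ (_ , nv) = next t , inj₁ (subst (s <_) (sym nv) (m≤n⇒m≤1+n s<t)) , e1
  ... | inj₂ (_ , nv) = next t , inj₂ nv , e1

  no-such-k : ⊥
  no-such-k with onF' | onF''
  ... | a , a≤1+s , ea | b , b-range , eb with FacetCycle.g-inj cyc a b (trans (sym ea) eb)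
  ... | refl = true≢false (trans (sym (Equivalence.from (newV kk k≢i k≢j) (a , endpoint b-range , ea))) ijk-no-vertex)
    where
    endpoint : (s < toℕ a ⊎ toℕ a ≡ 0) → toℕ a ≡ 0 ⊎ toℕ a ≡ suc s
    endpoint (inj₂ a≡0) = inj₁ a≡0
    endpoint (inj₁ s<a) = inj₂ (≤-antisym a≤1+s s<a)

belt-swap : ∀ (P : SimplePolytope) i j k → Belt3 P i j k → Belt3 P j i k
belt-swap P i j k ((c , e) , ejk , eik , f) =
  (c , trans (sym (IsSimple3Polytope.sym₁ (isSimple P) i j c)) e) , eik , ejk ,
  trans (IsSimple3Polytope.sym₁ (isSimple P) j i k) f

-- The facets of
-- the merged complex Q are those of P except j, relabelled as Fin m via
-- ι = punchIn j (and φ, collapsing j onto i, in the other direction); its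
-- vertices are the vertices of P, with j renamed to i.
module Merge (m : ℕ) (T : Fin (suc m) → Fin (suc m) → Fin (suc m) → Bool)
  (SP : IsSimple3Polytope (suc m) T) (i j : Fin (suc m)) (eij : AdjT T i j) where

  P : SimplePolytope
  P = record { n = suc m ; tri = T ; isSimple = SP }

  open Polytope P public hiding (T)

  i≢j : i ≢ j
  i≢j = proj₁ (t≢ (proj₂ eij))

  r : Fin N → Fin N
  r y = if eqB y j then i else y

  r' : Fin N → Fin N
  r' y = if eqB y i then j else y

  r-j : r j ≡ i
  r-j rewrite eqB-refl j = refl

  r-≢ : ∀ {y} → y ≢ j → r y ≡ y
  r-≢ y≢j rewrite eqB-≢ y≢j = refl

  r'-i : r' i ≡ j
  r'-i rewrite eqB-refl i = refl

  r'-≢ : ∀ {y} → y ≢ i → r' y ≡ y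
  r'-≢ y≢i rewrite eqB-≢ y≢i = refl

  r-cases : ∀ y → (y ≡ j × r y ≡ i) ⊎ (y ≢ j × r y ≡ y)
  r-cases y with y ≟ᶠ j
  ... | yes refl = inj₁ (refl , refl)
  ... | no y≢j = inj₂ (y≢j , refl)

  r'-cases : ∀ y → (y ≡ i × r' y ≡ j) ⊎ (y ≢ i × r' y ≡ y)
  r'-cases y with y ≟ᶠ i
  ... | yes refl = inj₁ (refl , refl)
  ... | no y≢i = inj₂ (y≢i , refl)

  r∘r' : ∀ {y} → y ≢ j → r (r' y) ≡ y
  r∘r' {y} y≢j with r'-cases y
  ... | inj₁ (refl , r'y) = trans (cong r r'y) r-j
  ... | inj₂ (_ , r'y) = trans (cong r r'y) (r-≢ y≢j)

  r'∘r : ∀ {y} → y ≢ i → r' (r y) ≡ y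
  r'∘r {y} y≢i with r-cases y
  ... | inj₁ (refl , ry) = trans (cong r' ry) r'-i
  ... | inj₂ (_ , ry) = trans (cong r' ry) (r'-≢ y≢i)

  r≢j : ∀ y → r y ≢ j
  r≢j y with r-cases y
  ... | inj₁ (_ , ry) = subst (_≢ j) (sym ry) i≢j
  ... | inj₂ (y≢j , ry) = subst (_≢ j) (sym ry) y≢j

  -- merged vertex relation on facets of P: a vertex of P, or a vertex of P
  -- once i is read as j
  T' : Fin N → Fin N → Fin N → Bool
  T' x y z = T x y z ∨ T (r' x) (r' y) (r' z)

  T≡ : ∀ {a b c a' b' c'} → a ≡ a' → b ≡ b' → c ≡ c' → T a b c ≡ true → T a' b' c' ≡ true
  T≡ refl refl refl e = e

  j-vertex⇒T' : ∀ {y z} → y ≢ i → z ≢ i → T j y z ≡ true → T' i y z ≡ true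
  j-vertex⇒T' {y} {z} y≢i z≢i e = ∨-true₂ {T i y z} (T≡ (sym r'-i) (sym (r'-≢ y≢i)) (sym (r'-≢ z≢i)) e)

  T'-second⇒j-vertex : ∀ {y z} → T (r' i) (r' y) (r' z) ≡ true → y ≢ i × z ≢ i × T j y z ≡ true
  T'-second⇒j-vertex {y} {z} e with r'-cases y | r'-cases z
  ... | inj₁ (refl , ry) | _ = ⊥-elim (true≢false (trans (sym (T≡ r'-i ry refl e)) (F12 j (r' z))))
  ... | inj₂ _ | inj₁ (refl , rz) = ⊥-elim (true≢false (trans (sym (T≡ r'-i refl rz e)) (F13 j (r' y))))
  ... | inj₂ (y≢i , ry) | inj₂ (z≢i , rz) = y≢i , z≢i , T≡ r'-i ry rz e

  ι : Fin m → Fin N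
  ι = punchIn j

  ι≢j : ∀ a → ι a ≢ j
  ι≢j a = punchInᵢ≢i j a

  ι-inj : ∀ {a b} → ι a ≡ ι b → a ≡ b
  ι-inj {a} {b} e = punchIn-injective j a b e

  φ : Fin N → Fin m
  φ x with j ≟ᶠ x
  ... | yes _ = punchOut {i = j} {j = i} (λ e → i≢j (sym e))
  ... | no j≢x = punchOut j≢x

  ιφ : ∀ x → x ≢ j → ι (φ x) ≡ x
  ιφ x x≢j with j ≟ᶠ x
  ... | yes j≡x = ⊥-elim (x≢j (sym j≡x))
  ... | no j≢x = punchIn-punchOut j≢x

  ιφ≡r : ∀ x → ι (φ x) ≡ r x
  ιφ≡r x with r-cases x
  ... | inj₂ (x≢j , rx) = trans (ιφ x x≢j) (sym rx)
  ... | inj₁ (refl , rx) = trans ιφj (sym rx)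
    where
    ιφj : ι (φ j) ≡ i
    ιφj with j ≟ᶠ j
    ... | yes _ = punchIn-punchOut _
    ... | no j≢j = ⊥-elim (j≢j refl)

  φι : ∀ a → φ (ι a) ≡ a
  φι a with j ≟ᶠ ι a
  ... | yes j≡ιa = ⊥-elim (ι≢j a (sym j≡ιa))
  ... | no _ = trans (punchOut-cong j refl) (punchOut-punchIn j)

  φ-inj : ∀ {x y} → x ≢ j → y ≢ j → φ x ≡ φ y → x ≡ y
  φ-inj {x} {y} x≢j y≢j e = trans (sym (ιφ x x≢j)) (trans (cong ι e) (ιφ y y≢j))

  φj≡φi : φ j ≡ φ i
  φj≡φi = ι-inj (trans (ιφ≡r j) (trans r-j (sym (ιφ i i≢j))))

  triQ : Fin m → Fin m → Fin m → Bool
  triQ a b c = T' (ι a) (ι b) (ι c)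

  module Transport (a : Fin m) (k : ℕ) (w : ℕ → Fin N) (k≥3 : 3 ≤ k) (wrap : w k ≡ w 0)
    (inj : ∀ s t → s < k → t < k → w s ≡ w t → s ≡ t)
    (avoid : ∀ t → t < k → w t ≢ j)
    (edges→ : ∀ y z → y ≢ j → z ≢ j → T' (ι a) y z ≡ true → Σ ℕ λ t → t < k × EdgeAt w t y z)
    (→edges : ∀ t → t < k → T' (ι a) (w t) (w (suc t)) ≡ true) where

    open CycleIndexing k w k≥3 wrap inj

    avoid-suc : ∀ t → t < k → w (suc t) ≢ j
    avoid-suc t t<k with norm (suc t) t<k
    ... | s' , s'<k , ws , _ = subst (_≢ j) (sym ws) (avoid s' s'<k)

    cycleQ : Cycle (triQ a)
    cycleQ = record
      { k = k ; w = λ t → φ (w t) ; k≥3 = k≥3 ; wrap = cong φ wrap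
      ; inj = λ s t s<k t<k e → inj s t s<k t<k (φ-inj (avoid s s<k) (avoid t t<k) e)
      ; edges→ = edgesQ
      ; →edges = λ t t<k → subst₂ (λ y z → T' (ι a) y z ≡ true)
                   (sym (ιφ (w t) (avoid t t<k))) (sym (ιφ (w (suc t)) (avoid-suc t t<k))) (→edges t t<k) }
      where
      edgesQ : ∀ b c → triQ a b c ≡ true → Σ ℕ λ t → t < k × EdgeAt (λ t → φ (w t)) t b c
      edgesQ b c e with edges→ (ι b) (ι c) (ι≢j b) (ι≢j c) e
      ... | t , t<k , edge = t , t<k , subst₂ (EdgeAt (λ t → φ (w t)) t) (φι b) (φι c) (edgeAt-map {w = w} {t = t} φ edge)

module Straighten (m : ℕ) (T : Fin (suc m) → Fin (suc m) → Fin (suc m) → Bool)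
  (SP : IsSimple3Polytope (suc m) T) (i j : Fin (suc m)) (eij : AdjT T i j)
  (no-belt : ¬ Σ (Fin (suc m)) λ k → Belt3 (Merge.P m T SP i j eij) i j k)
  (not-tet : ¬ IsTetrahedron (Merge.P m T SP i j eij)) where

  open Merge m T SP i j eij public

  tetrahedron⊥ : ∀ a b c d → T a b c ≡ true → T a b d ≡ true → T a c d ≡ true → T b c d ≡ true → ⊥
  tetrahedron⊥ a b c d abc abd acd bcd = not-tet (RecogniseTetrahedron.isTetrahedron a b c d abc abd acd bcd)

  common-nbr : ∀ z → AdjT T i z → AdjT T j z → T i j z ≡ true
  common-nbr z ai aj with T i j z in ijz
  ... | true = refl
  ... | false = ⊥-elim (no-belt (z , eij , aj , ai , ijz))

  endpoints : Σ (Fin N) λ a → Σ (Fin N) λ b → a ≢ b × T i j a ≡ true × T i j b ≡ true ×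
                (∀ c → T i j c ≡ true → c ≡ a ⊎ c ≡ b)
  endpoints = count≡2⇒pair (T i j) (edge2 i j eij)

  y1 y2 : Fin N
  y1 = proj₁ endpoints
  y2 = proj₁ (proj₂ endpoints)
  y1≢y2 : y1 ≢ y2
  y1≢y2 = proj₁ (proj₂ (proj₂ endpoints))
  Ty1 : T i j y1 ≡ true
  Ty1 = proj₁ (proj₂ (proj₂ (proj₂ endpoints)))
  Ty2 : T i j y2 ≡ true
  Ty2 = proj₁ (proj₂ (proj₂ (proj₂ (proj₂ endpoints))))
  y-only : ∀ z → T i j z ≡ true → z ≡ y1 ⊎ z ≡ y2
  y-only = proj₂ (proj₂ (proj₂ (proj₂ (proj₂ endpoints))))

  -- The polygons i = (j, y1, …, y2) and j = (i, y2, …, y1), of lengths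
  -- 3 + ℓi and 3 + ℓj.
  Ci' : Σ (Cycle (T i)) λ C → Cycle.w C 0 ≡ j × Cycle.w C 1 ≡ y1
  Ci' = linkCycle i j y1 Ty1
  Cj' : Σ (Cycle (T j)) λ C → Cycle.w C 0 ≡ i × Cycle.w C 1 ≡ y2
  Cj' = linkCycle j i y2 (P213 Ty2)
  module Ci = LinkCycle i (proj₁ Ci')
  module Cj = LinkCycle j (proj₁ Cj')

  wi0 : Ci.w 0 ≡ j
  wi0 = proj₁ (proj₂ Ci')
  wi1 : Ci.w 1 ≡ y1
  wi1 = proj₂ (proj₂ Ci')
  wj0 : Cj.w 0 ≡ i
  wj0 = proj₁ (proj₂ Cj')
  wj1 : Cj.w 1 ≡ y2
  wj1 = proj₂ (proj₂ Cj')

  ℓi : ℕ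
  ℓi = proj₁ (excess Ci.k Ci.k≥3)
  ℓi-eq : Ci.k ≡ 3 + ℓi
  ℓi-eq = proj₂ (excess Ci.k Ci.k≥3)
  ℓj : ℕ
  ℓj = proj₁ (excess Cj.k Cj.k≥3)
  ℓj-eq : Cj.k ≡ 3 + ℓj
  ℓj-eq = proj₂ (excess Cj.k Cj.k≥3)

  <i : ∀ {s} → s < 3 + ℓi → s < Ci.k
  <i {s} lt = subst (s <_) (sym ℓi-eq) lt
  <j : ∀ {s} → s < 3 + ℓj → s < Cj.k
  <j {s} lt = subst (s <_) (sym ℓj-eq) lt
  <i' : ∀ {s} → s < Ci.k → s < 3 + ℓi
  <i' {s} lt = subst (s <_) ℓi-eq lt
  <j' : ∀ {s} → s < Cj.k → s < 3 + ℓj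
  <j' {s} lt = subst (s <_) ℓj-eq lt

  -- the vertices 2, …, 1 + ℓj of j's polygon are the ones that survive in the merged facet
  j-inner : ∀ {u} → u < ℓj → 2 + u < Cj.k
  j-inner u<ℓj = <j (s≤s (s≤s (m≤n⇒m≤1+n u<ℓj)))

  wi-wrap : Ci.w (3 + ℓi) ≡ j
  wi-wrap = trans (cong Ci.w (sym ℓi-eq)) (trans Ci.wrap wi0)
  wj-wrap : Cj.w (3 + ℓj) ≡ i
  wj-wrap = trans (cong Cj.w (sym ℓj-eq)) (trans Cj.wrap wj0)

  wi-last : Ci.w (2 + ℓi) ≡ y2
  wi-last with y-only (Ci.w (2 + ℓi))
                (P132 (subst (λ z → T i (Ci.w (2 + ℓi)) z ≡ true) wi-wrap (Ci.→edges (2 + ℓi) (<i ≤-refl))))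
  ... | inj₂ e = e
  ... | inj₁ e with Ci.inj (2 + ℓi) 1 (<i ≤-refl) (<i (s≤s (s≤s z≤n))) (trans e (sym wi1))
  ...   | ()
  wj-last : Cj.w (2 + ℓj) ≡ y1
  wj-last with y-only (Cj.w (2 + ℓj))
                (P213 (P132 (subst (λ z → T j (Cj.w (2 + ℓj)) z ≡ true) wj-wrap (Cj.→edges (2 + ℓj) (<j ≤-refl)))))
  ... | inj₁ e = e
  ... | inj₂ e with Cj.inj (2 + ℓj) 1 (<j ≤-refl) (<j (s≤s (s≤s z≤n))) (trans e (sym wj1))
  ...   | ()

  -- The merged polygon: g 0, …, g (K-1) = y1, …, y2 (from i), then the
  -- remaining neighbours of j up to y1; K = (3 + ℓi) + (3 + ℓj) - 4.
  Ki : ℕ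
  Ki = 2 + ℓi
  K : ℕ
  K = Ki + ℓj

  opaque
    g : ℕ → Fin N
    g t with t <? Ki
    ... | yes _ = Ci.w (suc t)
    ... | no _ = Cj.w (2 + (t ∸ Ki))

    g-lo : ∀ t → t < Ki → g t ≡ Ci.w (suc t)
    g-lo t t<Ki with t <? Ki
    ... | yes _ = refl
    ... | no t≮Ki = ⊥-elim (t≮Ki t<Ki)

    g-hi : ∀ u → g (Ki + u) ≡ Cj.w (2 + u)
    g-hi u with Ki + u <? Ki
    ... | yes lt = ⊥-elim (<-irrefl refl (≤-trans lt (m≤m+n Ki u)))
    ... | no _ = cong (λ z → Cj.w (2 + z)) (m+n∸m≡n Ki u)

  split-index : ∀ t → t < K → t < Ki ⊎ Σ ℕ λ u → t ≡ Ki + u × u < ℓj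
  split-index t t<K with t <? Ki
  ... | yes t<Ki = inj₁ t<Ki
  ... | no t≮Ki = inj₂ (t ∸ Ki , sym t≡ , +-cancelˡ-< Ki (t ∸ Ki) ℓj (subst (_< K) (sym t≡) t<K))
    where
    t≡ : Ki + (t ∸ Ki) ≡ t
    t≡ = m+[n∸m]≡n (≮⇒≥ t≮Ki)

  g-wrap : g K ≡ g 0
  g-wrap = trans (g-hi ℓj) (trans wj-last (trans (sym wi1) (sym (g-lo 0 (s≤s z≤n)))))

  g0 : g 0 ≡ y1
  g0 = trans (g-lo 0 (s≤s z≤n)) wi1

  g-y2 : g (1 + ℓi) ≡ y2
  g-y2 = trans (g-lo (1 + ℓi) ≤-refl) wi-last

  wi≢j : ∀ s → 0 < s → s < 3 + ℓi → Ci.w s ≢ j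
  wi≢j s 0<s s< e with Ci.is0 s (<i s<) (trans e (sym wi0))
  wi≢j (suc s) 0<s s< e | ()
  wj≢i : ∀ s → 0 < s → s < 3 + ℓj → Cj.w s ≢ i
  wj≢i s 0<s s< e with Cj.is0 s (<j s<) (trans e (sym wj0))
  wj≢i (suc s) 0<s s< e | ()

  g≢j : ∀ t → t < K → g t ≢ j
  g≢j t t<K with split-index t t<K
  ... | inj₁ t<Ki = subst (_≢ j) (sym (g-lo t t<Ki)) (wi≢j (suc t) (s≤s z≤n) (s≤s t<Ki))
  ... | inj₂ (u , refl , u<ℓj) = subst (_≢ j) (sym (g-hi u)) (Cj.w≢x (2 + u) (j-inner u<ℓj))

  -- The two halves of g are disjoint: a facet in both would be a common
  -- neighbour of i and j, hence y1 or y2, which occur in j only at the ends.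
  halves-disjoint : ∀ s v → s < Ki → v < ℓj → Ci.w (suc s) ≢ Cj.w (2 + v)
  halves-disjoint s v s<Ki v<ℓj e with y-only (Ci.w (suc s)) (common-nbr _ ai aj)
    where
    ai : AdjT T i (Ci.w (suc s))
    ai = Ci.adj (suc s) (<i (s≤s s<Ki))
    aj : AdjT T j (Ci.w (suc s))
    aj = subst (AdjT T j) (sym e) (Cj.adj (2 + v) (j-inner v<ℓj))
  ... | inj₁ e1 with Cj.inj (2 + v) (2 + ℓj) (j-inner v<ℓj) (<j ≤-refl) (trans (sym e) (trans e1 (sym wj-last)))
  ...   | v≡ℓj = <-irrefl (cong (λ z → z ∸ 2) v≡ℓj) v<ℓj
  halves-disjoint s v s<Ki v<ℓj e | inj₂ e2
    with Cj.inj (2 + v) 1 (j-inner v<ℓj) (<j (s≤s (s≤s z≤n))) (trans (sym e) (trans e2 (sym wj1)))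
  ... | ()

  g-inj : ∀ s t → s < K → t < K → g s ≡ g t → s ≡ t
  g-inj s t s< t< e with split-index s s< | split-index t t<
  ... | inj₁ a | inj₁ b = suc-injective (Ci.inj (suc s) (suc t) (<i (s≤s a)) (<i (s≤s b))
          (trans (sym (g-lo s a)) (trans e (g-lo t b))))
  ... | inj₁ a | inj₂ (v , refl , v<) = ⊥-elim (halves-disjoint s v a v< (trans (sym (g-lo s a)) (trans e (g-hi v))))
  ... | inj₂ (u , refl , u<) | inj₁ b = ⊥-elim (halves-disjoint t u b u< (trans (sym (g-lo t b)) (trans (sym e) (g-hi u))))
  ... | inj₂ (u , refl , u<) | inj₂ (v , refl , v<) =
          cong (Ki +_) (cong (λ z → z ∸ 2) (Cj.inj (2 + u) (2 + v) (j-inner u<) (j-inner v<)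
            (trans (sym (g-hi u)) (trans e (g-hi v)))))

  -- If both i and j were triangles, i, j, y1, y2 would form a tetrahedron.
  K≥3 : 3 ≤ K
  K≥3 with ℓi ≟ℕ 0 | ℓj ≟ℕ 0
  ... | no ℓi≢0 | _ = ≥3-left ℓi ℓi≢0
    where
    ≥3-left : ∀ a → a ≢ 0 → 3 ≤ 2 + a + ℓj
    ≥3-left zero a≢0 = ⊥-elim (a≢0 refl)
    ≥3-left (suc a) _ = s≤s (s≤s (s≤s z≤n))
  ... | yes _ | no ℓj≢0 = ≥3-right ℓi ℓj ℓj≢0
    where
    ≥3-right : ∀ a b → b ≢ 0 → 3 ≤ 2 + a + b
    ≥3-right a zero b≢0 = ⊥-elim (b≢0 refl)
    ≥3-right a (suc b) _ = s≤s (s≤s (subst (1 ≤_) (sym (+-suc a b)) (s≤s z≤n)))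
  ... | yes ℓi≡0 | yes ℓj≡0 = ⊥-elim (tetrahedron⊥ i j y1 y2 Ty1 Ty2 iy1y2 jy1y2)
    where
    wi2 : Ci.w 2 ≡ y2
    wi2 = trans (cong (λ z → Ci.w (2 + z)) (sym ℓi≡0)) wi-last
    wj2 : Cj.w 2 ≡ y1
    wj2 = trans (cong (λ z → Cj.w (2 + z)) (sym ℓj≡0)) wj-last
    iy1y2 : T i y1 y2 ≡ true
    iy1y2 = subst₂ (λ a b → T i a b ≡ true) wi1 wi2 (Ci.→edges 1 (<i (s≤s (s≤s z≤n))))
    jy1y2 : T j y1 y2 ≡ true
    jy1y2 = P132 (subst₂ (λ a b → T j a b ≡ true) wj1 wj2 (Cj.→edges 1 (<j (s≤s (s≤s z≤n)))))

  g-edges← : ∀ t → t < K → T' i (g t) (g (suc t)) ≡ true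
  g-edges← t t<K with split-index t t<K
  ... | inj₂ (u , refl , u<ℓj) =
    subst₂ (λ a b → T' i a b ≡ true) (sym (g-hi u)) (trans (sym (g-hi (suc u))) (cong g (+-suc Ki u)))
      (j-vertex⇒T' (wj≢i (2 + u) (s≤s z≤n) (<j' (j-inner u<ℓj))) (wj≢i (3 + u) (s≤s z≤n) (s≤s (s≤s (s≤s u<ℓj))))
        (Cj.→edges (2 + u) (j-inner u<ℓj)))
  ... | inj₁ t<Ki with m≤n⇒m<n∨m≡n t<Ki
  ...   | inj₁ t+1<Ki = subst₂ (λ a b → T' i a b ≡ true) (sym (g-lo t t<Ki)) (sym (g-lo (suc t) t+1<Ki))
          (∨-true₁ (Ci.→edges (suc t) (<i (m≤n⇒m≤1+n t+1<Ki))))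
  ...   | inj₂ t+1≡Ki = subst₂ (λ a b → T' i a b ≡ true)
          (sym (trans (cong g (suc-injective t+1≡Ki)) g-y2))
          (sym (trans (cong g (trans t+1≡Ki (sym (+-identityʳ Ki)))) (g-hi 0)))
          (j-vertex⇒T' (λ e → proj₂ (proj₂ (t≢ Ty2)) (sym e)) (wj≢i 2 (s≤s z≤n) (s≤s (s≤s (s≤s z≤n))))
            (subst (λ a → T j a (Cj.w 2) ≡ true) wj1 (Cj.→edges 1 (<j (s≤s (s≤s z≤n))))))

  g-edges→ : ∀ y z → y ≢ j → z ≢ j → T' i y z ≡ true → Σ ℕ λ t → t < K × EdgeAt g t y z
  g-edges→ y z y≢j z≢j e with ∨-elim {T i y z} e
  ... | inj₁ iyz with Ci.edges→ y z iyz
  ...   | s , s<k , edge with Ci.interior s y z s<k edge (λ q → y≢j (trans q wi0)) (λ q → z≢j (trans q wi0))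
  ...     | s' , refl , lt = s' , ≤-trans s'<Ki (m≤m+n Ki ℓj) ,
            edgeAt-cong {w = Ci.w} {v = g} (g-lo s' s'<Ki) (g-lo (suc s') s'+1<Ki) edge
    where
    s'+1<Ki : suc s' < Ki
    s'+1<Ki = ≤-pred (<i' lt)
    s'<Ki : s' < Ki
    s'<Ki = <-trans (n<1+n s') s'+1<Ki
  g-edges→ y z y≢j z≢j e | inj₂ e2 with T'-second⇒j-vertex {y} {z} e2
  ... | y≢i , z≢i , jyz with Cj.edges→ y z jyz
  ...   | u , u<k , edge with Cj.interior u y z u<k edge (λ q → y≢i (trans q wj0)) (λ q → z≢i (trans q wj0))
  ...     | zero , refl , _ = 1 + ℓi , m≤m+n Ki ℓj ,
            edgeAt-cong {w = Cj.w} {v = g} (trans g-y2 (sym wj1)) (trans (cong g (sym (+-identityʳ Ki))) (g-hi 0)) edge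
  ...     | suc v , refl , lt = Ki + v , +-monoʳ-< Ki (≤-pred (≤-pred (≤-pred (<j' lt)))) ,
            edgeAt-cong {w = Cj.w} {v = g} (g-hi v) (trans (cong g (sym (+-suc Ki v))) (g-hi (suc v))) edge

  Fa : Fin m
  Fa = φ i
  ιFa : ι Fa ≡ i
  ιFa = ιφ i i≢j

  module MergedLink = Transport Fa K g K≥3 g-wrap g-inj g≢j
    (λ y z y≢j z≢j e → g-edges→ y z y≢j z≢j (subst (λ x → T' x y z ≡ true) ιFa e))
    (λ t t<K → subst (λ x → T' x (g t) (g (suc t)) ≡ true) (sym ιFa) (g-edges← t t<K))

  cycleP : ∀ x → Cycle (T x)
  cycleP x = proj₁ (linkCycle x (proj₁ (nonempty x)) (proj₁ (proj₂ (nonempty x))) (proj₂ (proj₂ (nonempty x))))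

  kP : Fin N → ℕ
  kP x = Cycle.k (cycleP x)

  -- A facet x ≠ i, j adjacent to at most one of i, j keeps its polygon, with
  -- j renamed to i.
  module NotBoth (x : Fin N) (x≢i : x ≢ i) (x≢j : x ≢ j) (not-both : ¬ (AdjT T x i × AdjT T x j)) where
    C : Cycle (T x)
    C = cycleP x
    open LinkCycle x C

    w' : ℕ → Fin N
    w' t = r (w t)

    r-inj : ∀ u v → AdjT T x u → AdjT T x v → r u ≡ r v → u ≡ v
    r-inj u v au av e with r-cases u | r-cases v
    ... | inj₁ (refl , ru) | inj₁ (refl , rv) = refl
    ... | inj₁ (refl , ru) | inj₂ (_ , rv) = ⊥-elim (not-both (subst (AdjT T x) (trans (sym rv) (trans (sym e) ru)) av , au))
    ... | inj₂ (_ , ru) | inj₁ (refl , rv) = ⊥-elim (not-both (subst (AdjT T x) (trans (sym ru) (trans e rv)) au , av))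
    ... | inj₂ (_ , ru) | inj₂ (_ , rv) = trans (sym ru) (trans e rv)

    avoid : ∀ t → t < k → w' t ≢ j
    avoid t _ = r≢j (w t)

    w'-inj : ∀ s t → s < k → t < k → w' s ≡ w' t → s ≡ t
    w'-inj s t s< t< e = inj s t s< t< (r-inj (w s) (w t) (adj s s<) (adj t t<) e)

    adj-suc : ∀ t → t < k → AdjT T x (w (suc t))
    adj-suc t t<k = w t , P132 (→edges t t<k)

    merged-edges← : ∀ t → t < k → T' x (w' t) (w' (suc t)) ≡ true
    merged-edges← t t<k with decAdj T x j
    ... | no ¬adj-j = ∨-true₁ (T≡ refl (sym (r-≢ (≢j t t<k))) (sym (r-≢ ≢j-suc)) (→edges t t<k))
      where
      ≢j : ∀ t → t < k → w t ≢ j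
      ≢j t t<k e = ¬adj-j (subst (AdjT T x) e (adj t t<k))
      ≢j-suc : w (suc t) ≢ j
      ≢j-suc e = ¬adj-j (subst (AdjT T x) e (adj-suc t t<k))
    ... | yes adj-j = ∨-true₂ {T x (w' t) (w' (suc t))}
        (T≡ (sym (r'-≢ x≢i)) (sym (r'∘r ≢i)) (sym (r'∘r ≢i-suc)) (→edges t t<k))
      where
      ≢i : w t ≢ i
      ≢i e = not-both (subst (AdjT T x) e (adj t t<k) , adj-j)
      ≢i-suc : w (suc t) ≢ i
      ≢i-suc e = not-both (subst (AdjT T x) e (adj-suc t t<k) , adj-j)

    merged-edges→ : ∀ y z → y ≢ j → z ≢ j → T' x y z ≡ true → Σ ℕ λ t → t < k × EdgeAt w' t y z
    merged-edges→ y z y≢j z≢j e with ∨-elim {T x y z} e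
    ... | inj₁ xyz with Cycle.edges→ C y z xyz
    ...   | s , s< , edge = s , s< , subst₂ (EdgeAt w' s) (r-≢ y≢j) (r-≢ z≢j) (edgeAt-map {w = w} r edge)
    merged-edges→ y z y≢j z≢j e | inj₂ e2 with Cycle.edges→ C (r' y) (r' z) (T≡ (r'-≢ x≢i) refl refl e2)
    ... | s , s< , edge = s , s< , subst₂ (EdgeAt w' s) (r∘r' y≢j) (r∘r' z≢j) (edgeAt-map {w = w} r edge)

  -- A facet x ≠ i, j adjacent to both i and j meets the edge i ∩ j; in its
  -- polygon (j, i, …) the two consecutive sides on j and i merge into one,
  -- so its length drops by one: the cycle i, w 2, …, w (k-1).
  module Both (x : Fin N) (x≢i : x ≢ i) (x≢j : x ≢ j) (ai : AdjT T x i) (aj : AdjT T x j) where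
    ijx : T i j x ≡ true
    ijx = common-nbr x (proj₁ ai , P213 (proj₂ ai)) (proj₁ aj , P213 (proj₂ aj))

    C' : Σ (Cycle (T x)) λ C → Cycle.w C 0 ≡ j × Cycle.w C 1 ≡ i
    C' = linkCycle x j i (P132 (P312 ijx))
    open LinkCycle x (proj₁ C')

    w0 : w 0 ≡ j
    w0 = proj₁ (proj₂ C')
    w1 : w 1 ≡ i
    w1 = proj₂ (proj₂ C')

    ℓx : ℕ
    ℓx = proj₁ (excess k k≥3)
    ℓx-eq : k ≡ 3 + ℓx
    ℓx-eq = proj₂ (excess k k≥3)

    -- x is not a triangle: otherwise i, j, x, w 2 form a tetrahedron
    ℓx≢0 : ℓx ≢ 0
    ℓx≢0 ℓx≡0 = tetrahedron⊥ i j x z ijx ijz (P213 xiz) (P312 xzj)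
      where
      z : Fin N
      z = w 2
      k≡3 : k ≡ 3
      k≡3 = trans ℓx-eq (cong (3 +_) ℓx≡0)
      xiz : T x i z ≡ true
      xiz = subst (λ a → T x a z ≡ true) w1 (→edges 1 (subst (1 <_) (sym k≡3) (s≤s (s≤s z≤n))))
      xzj : T x z j ≡ true
      xzj = subst (λ a → T x z a ≡ true) (trans (cong w (sym k≡3)) (trans wrap w0)) (→edges 2 (subst (2 <_) (sym k≡3) ≤-refl))
      ijz : T i j z ≡ true
      ijz = common-nbr z (x , P231 xiz) (x , P321 xzj)

    last k' : ℕ
    last = 2 + pred ℓx
    k' = suc last
    k≡1+k' : k ≡ suc k'
    k≡1+k' = trans ℓx-eq (cong (3 +_) (nonzero ℓx ℓx≢0))
      where
      nonzero : ∀ a → a ≢ 0 → a ≡ suc (pred a)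
      nonzero zero a≢0 = ⊥-elim (a≢0 refl)
      nonzero (suc a) _ = refl

    <k : ∀ {s} → s < suc k' → s < k
    <k {s} l = subst (s <_) (sym k≡1+k') l

    w' : ℕ → Fin N
    w' t with t ≟ℕ k'
    ... | yes _ = w 1
    ... | no _ = w (suc t)

    w'-lo : ∀ t → t < k' → w' t ≡ w (suc t)
    w'-lo t t<k' with t ≟ℕ k'
    ... | yes refl = ⊥-elim (<-irrefl refl t<k')
    ... | no _ = refl

    w'-k' : w' k' ≡ i
    w'-k' with k' ≟ℕ k'
    ... | yes _ = w1
    ... | no k'≢k' = ⊥-elim (k'≢k' refl)

    w'-wrap : w' k' ≡ w' 0
    w'-wrap = trans w'-k' (sym (trans (w'-lo 0 (s≤s z≤n)) w1))

    avoid : ∀ t → t < k' → w' t ≢ j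
    avoid t t<k' e with is0 (suc t) (<k (s≤s t<k')) (trans (trans (sym (w'-lo t t<k')) e) (sym w0))
    ... | ()

    w'-inj : ∀ s t → s < k' → t < k' → w' s ≡ w' t → s ≡ t
    w'-inj s t s< t< e = suc-injective (inj (suc s) (suc t) (<k (s≤s s<)) (<k (s≤s t<))
      (trans (sym (w'-lo s s<)) (trans e (w'-lo t t<))))

    wk'≢i : w k' ≢ i
    wk'≢i e with inj k' 1 (<k ≤-refl) (<k (s≤s (s≤s z≤n))) (trans e (sym w1))
    ... | ()

    w-last : w (suc k') ≡ j
    w-last = trans (cong w (sym k≡1+k')) (trans wrap w0)

    merged-edges← : ∀ t → t < k' → T' x (w' t) (w' (suc t)) ≡ true
    merged-edges← t t<k' with m≤n⇒m<n∨m≡n t<k'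
    ... | inj₁ t+1<k' = ∨-true₁ (subst₂ (λ a b → T x a b ≡ true) (sym (w'-lo t t<k')) (sym (w'-lo (suc t) t+1<k'))
                       (→edges (suc t) (<k (s≤s t<k'))))
    ... | inj₂ refl = ∨-true₂ {T x (w' t) (w' (suc t))}
          (T≡ (sym (r'-≢ x≢i)) (trans (sym (r'-≢ wk'≢i)) (cong r' (sym (w'-lo t t<k')))) (trans (sym r'-i) (cong r' (sym w'-k')))
            (subst (λ a → T x (w k') a ≡ true) w-last (→edges k' (<k ≤-refl))))

    edges→-old : ∀ y z → y ≢ j → z ≢ j → T x y z ≡ true → Σ ℕ λ t → t < k' × EdgeAt w' t y z
    edges→-old y z y≢j z≢j e with edges→ y z e
    ... | s , s< , edge with interior s y z s< edge (λ q → y≢j (trans q w0)) (λ q → z≢j (trans q w0))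
    ... | s' , refl , lt = s' , s'<k' , edgeAt-cong {w = w} {v = w'} {s = suc s'} {t = s'} (w'-lo s' s'<k') (w'-lo (suc s') s'+1<k') edge
      where
      s'+1<k' : suc s' < k'
      s'+1<k' = ≤-pred (subst (suc (suc s') <_) k≡1+k' lt)
      s'<k' : s' < k'
      s'<k' = <-trans (n<1+n s') s'+1<k'

    -- the side of x on j (reached from the last vertex w k') becomes the new closing side
    closing-side : ∀ z → z ≢ i → T x j z ≡ true → z ≡ w' last
    closing-side z z≢i xjz with edges→ j z xjz
    ... | s , s< , inj₁ (e1 , e2) with is0 s s< (trans (sym e1) (sym w0))
    ...   | refl = ⊥-elim (z≢i (trans e2 w1))
    closing-side z z≢i xjz | s , s< , inj₂ (e1 , e2) with isK s s< (trans (sym e1) (sym w0))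
    ...   | s+1≡k = trans e2 (trans (cong w (suc-injective (trans s+1≡k k≡1+k'))) (sym (w'-lo last ≤-refl)))

    merged-edges→ : ∀ y z → y ≢ j → z ≢ j → T' x y z ≡ true → Σ ℕ λ t → t < k' × EdgeAt w' t y z
    merged-edges→ y z y≢j z≢j e with ∨-elim {T x y z} e
    ... | inj₁ xyz = edges→-old y z y≢j z≢j xyz
    ... | inj₂ e2 with r'-cases y | r'-cases z
    ...   | inj₂ (y≢i , ry) | inj₂ (z≢i , rz) = edges→-old y z y≢j z≢j (T≡ (r'-≢ x≢i) ry rz e2)
    ...   | inj₁ (refl , ry) | inj₁ (_ , rz) = ⊥-elim (true≢false (trans (sym (T≡ (r'-≢ x≢i) ry rz e2)) (F23 x j)))
    ...   | inj₁ (refl , ry) | inj₂ (z≢i , rz) =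
            last , ≤-refl , inj₂ (sym w'-k' , closing-side z z≢i (T≡ (r'-≢ x≢i) ry rz e2))
    ...   | inj₂ (y≢i , ry) | inj₁ (refl , rz) =
            last , ≤-refl , inj₁ (closing-side y y≢i (P132 (T≡ (r'-≢ x≢i) ry rz e2)) , sym w'-k')

  δ : Fin m → Fin m → ℕ → ℕ
  δ a b v = if eqB a b then v else 0

  δ-≢ : ∀ {a b} v → a ≢ b → δ a b v ≡ 0
  δ-≢ {a} {b} v a≢b rewrite eqB-≢ a≢b = refl

  δ-refl : ∀ a v → δ a a v ≡ v
  δ-refl a v rewrite eqB-refl a = refl

  -- How the length of a polygon changes under merging: the merged facet has
  -- kP i + kP j - 4 sides, the facets y1, y2 at the ends of the edge lose one
  -- side each, and all others keep their length.
  LengthChange : Fin m → ℕ → Set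
  LengthChange a k = k + δ a Fa 4 + δ a (φ y1) 1 + δ a (φ y2) 1 ≡ kP (ι a) + δ a Fa (kP j)

  y-adj : ∀ y → T i j y ≡ true → AdjT T y i × AdjT T y j
  y-adj y e = (j , P312 e) , (i , P321 e)

  y1≢i : y1 ≢ i
  y1≢i e = proj₂ (proj₂ (t≢ Ty1)) (sym e)
  y2≢i : y2 ≢ i
  y2≢i e = proj₂ (proj₂ (t≢ Ty2)) (sym e)
  y1≢j : y1 ≢ j
  y1≢j e = proj₁ (proj₂ (t≢ Ty1)) (sym e)
  y2≢j : y2 ≢ j
  y2≢j e = proj₁ (proj₂ (t≢ Ty2)) (sym e)

  cong-last3 : ∀ {k a b c a' b' c' : ℕ} → a ≡ a' → b ≡ b' → c ≡ c' → k + a + b + c ≡ k + a' + b' + c'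
  cong-last3 refl refl refl = refl

  kP-unique : ∀ x (C : Cycle (T x)) → kP x ≡ Cycle.k C
  kP-unique x C = cycle-length-unique (sym₂ x) (cycleP x) C

  merged-cycle : Σ (Cycle (triQ Fa)) λ C → LengthChange Fa (Cycle.k C)
  merged-cycle = MergedLink.cycleQ , change
    where
    Fa≢φy1 : Fa ≢ φ y1
    Fa≢φy1 q = y1≢i (trans (sym (ιφ y1 y1≢j)) (trans (cong ι (sym q)) ιFa))
    Fa≢φy2 : Fa ≢ φ y2
    Fa≢φy2 q = y2≢i (trans (sym (ιφ y2 y2≢j)) (trans (cong ι (sym q)) ιFa))
    arith : ∀ a b → 2 + a + b + 4 + 0 + 0 ≡ 3 + a + (3 + b)
    arith = solve-∀
    change : LengthChange Fa K
    change = trans (cong-last3 (δ-refl Fa 4) (δ-≢ 1 Fa≢φy1) (δ-≢ 1 Fa≢φy2))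
             (trans (arith ℓi ℓj)
               (sym (cong₂ _+_ (trans (cong kP ιFa) (trans (kP-unique i (proj₁ Ci')) ℓi-eq))
                               (trans (δ-refl Fa (kP j)) (trans (kP-unique j (proj₁ Cj')) ℓj-eq)))))

  -- the polygon of a facet adjacent to both i and j: one of y1, y2, losing one side
  both-cycle : ∀ a → ι a ≢ i → AdjT T (ι a) i → AdjT T (ι a) j → Σ (Cycle (triQ a)) λ C → LengthChange a (Cycle.k C)
  both-cycle a x≢i ai aj = B'.cycleQ , change
    where
    x : Fin N
    x = ι a
    module B = Both x x≢i (ι≢j a) ai aj
    module B' = Transport a B.k' B.w' (s≤s (s≤s (s≤s z≤n))) B.w'-wrap B.w'-inj B.avoid B.merged-edges→ B.merged-edges←
    a≢Fa : a ≢ Fa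
    a≢Fa q = x≢i (trans (cong ι q) ιFa)
    kP≡ : kP x ≡ suc B.k'
    kP≡ = trans (kP-unique x (proj₁ B.C')) B.k≡1+k'
    is-y : ∀ {y} → x ≡ y → y ≢ j → δ a (φ y) 1 ≡ 1
    is-y {y} x≡y y≢j = trans (cong (λ z → δ a z 1) (trans (cong φ (sym x≡y)) (φι a))) (δ-refl a 1)
    not-y : ∀ {y y'} → x ≡ y → y' ≢ y → y' ≢ j → δ a (φ y') 1 ≡ 0
    not-y {y} {y'} x≡y y'≢y y'≢j = δ-≢ 1 (λ q → y'≢y (trans (sym (ιφ y' y'≢j)) (trans (cong ι (sym q)) x≡y)))
    change : LengthChange a B.k'
    change with y-only x B.ijx
    ... | inj₁ x≡y1 = trans (cong-last3 (δ-≢ 4 a≢Fa) (is-y x≡y1 y1≢j) (not-y x≡y1 (λ e → y1≢y2 (sym e)) y2≢j))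
             (trans (arith B.k') (sym (cong₂ _+_ kP≡ (δ-≢ (kP j) a≢Fa))))
      where
      arith : ∀ a → a + 0 + 1 + 0 ≡ suc a + 0
      arith = solve-∀
    ... | inj₂ x≡y2 = trans (cong-last3 (δ-≢ 4 a≢Fa) (not-y x≡y2 y1≢y2 y1≢j) (is-y x≡y2 y2≢j))
             (trans (arith B.k') (sym (cong₂ _+_ kP≡ (δ-≢ (kP j) a≢Fa))))
      where
      arith : ∀ a → a + 0 + 0 + 1 ≡ suc a + 0
      arith = solve-∀

  not-both-cycle : ∀ a → ι a ≢ i → ¬ (AdjT T (ι a) i × AdjT T (ι a) j) → Σ (Cycle (triQ a)) λ C → LengthChange a (Cycle.k C)
  not-both-cycle a x≢i not-both = N'.cycleQ , change
    where
    x : Fin N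
    x = ι a
    module N = NotBoth x x≢i (ι≢j a) not-both
    module N' = Transport a (Cycle.k N.C) N.w' (Cycle.k≥3 N.C) (cong r (Cycle.wrap N.C)) N.w'-inj N.avoid N.merged-edges→ N.merged-edges←
    a≢Fa : a ≢ Fa
    a≢Fa q = x≢i (trans (cong ι q) ιFa)
    a≢φy : ∀ y → T i j y ≡ true → y ≢ j → a ≢ φ y
    a≢φy y e y≢j q = not-both (subst (λ z → AdjT T z i × AdjT T z j) (sym (trans (cong ι q) (ιφ y y≢j))) (y-adj y e))
    arith : ∀ a → a + 0 + 0 + 0 ≡ a + 0
    arith = solve-∀
    change : LengthChange a (Cycle.k N.C)
    change = trans (cong-last3 (δ-≢ 4 a≢Fa) (δ-≢ 1 (a≢φy y1 Ty1 y1≢j)) (δ-≢ 1 (a≢φy y2 Ty2 y2≢j)))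
             (trans (arith (Cycle.k N.C)) (sym (cong₂ _+_ (kP-unique x N.C) (δ-≢ (kP j) a≢Fa))))

  -- (a separate test, so that the decision does not get abstracted in triQ)
  is-merged? : ∀ a → ι a ≡ i ⊎ ι a ≢ i
  is-merged? a with ι a ≟ᶠ i
  ... | yes ιa≡i = inj₁ ιa≡i
  ... | no ιa≢i = inj₂ ιa≢i

  cycleQ-with-length : ∀ a → Σ (Cycle (triQ a)) λ C → LengthChange a (Cycle.k C)
  cycleQ-with-length a with is-merged? a
  ... | inj₁ ιa≡i = subst (λ a → Σ (Cycle (triQ a)) λ C → LengthChange a (Cycle.k C)) (sym a≡Fa) merged-cycle
    where
    a≡Fa : a ≡ Fa
    a≡Fa = ι-inj (trans ιa≡i (sym ιFa))
  ... | inj₂ x≢i with decAdj T (ι a) i | decAdj T (ι a) j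
  ...   | yes ai | yes aj = both-cycle a x≢i ai aj
  ...   | no ¬ai | _ = not-both-cycle a x≢i (λ p → ¬ai (proj₁ p))
  ...   | yes _ | no ¬aj = not-both-cycle a x≢i (λ p → ¬aj (proj₂ p))

  cycleQ : ∀ a → Cycle (triQ a)
  cycleQ a = proj₁ (cycleQ-with-length a)

  kQ : Fin m → ℕ
  kQ a = Cycle.k (cycleQ a)

  symQ : ∀ a → Symm (triQ a)
  symQ a b c = cong₂ _∨_ (sym₂ (ι a) (ι b) (ι c)) (sym₂ (r' (ι a)) (r' (ι b)) (r' (ι c)))

  -- Connectivity of Q: every adjacency of P survives in Q (or collapses, for
  -- i, j).  First, a vertex of P not on both i and j is a vertex of Q.
  vertex-survives : ∀ x y c → T x y c ≡ true →
    (x ≢ j × y ≢ j × c ≢ j) ⊎ (x ≢ i × y ≢ i × c ≢ i) → T' (r x) (r y) (r c) ≡ true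
  vertex-survives x y c e (inj₁ (x≢j , y≢j , c≢j)) = ∨-true₁ (T≡ (sym (r-≢ x≢j)) (sym (r-≢ y≢j)) (sym (r-≢ c≢j)) e)
  vertex-survives x y c e (inj₂ (x≢i , y≢i , c≢i)) =
    ∨-true₂ {T (r x) (r y) (r c)} (T≡ (sym (r'∘r x≢i)) (sym (r'∘r y≢i)) (sym (r'∘r c≢i)) e)

  other-end : ∀ x y c → T x y c ≡ true → Σ (Fin N) λ c' → T x y c' ≡ true × c' ≢ c
  other-end x y c e with count≡2⇒pair (T x y) (edge2 x y (c , e))
  ... | u , v , u≢v , tu , tv , _ with u ≟ᶠ c
  ... | yes refl = v , tv , (λ q → u≢v (sym q))
  ... | no u≢c = u , tu , u≢c

  data Kind (z : Fin N) : Set where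
    isI : z ≡ i → Kind z
    isJ : z ≡ j → Kind z
    neither : z ≢ i → z ≢ j → Kind z

  kind : ∀ z → Kind z
  kind z with z ≟ᶠ i | z ≟ᶠ j
  ... | yes z≡i | _ = isI z≡i
  ... | no _ | yes z≡j = isJ z≡j
  ... | no z≢i | no z≢j = neither z≢i z≢j

  j≢i : j ≢ i
  j≢i e = i≢j (sym e)

  good-endpoint : ∀ x y c → T x y c ≡ true → x ≢ i → x ≢ j →
    Σ (Fin N) λ c' → T x y c' ≡ true × ((x ≢ j × y ≢ j × c' ≢ j) ⊎ (x ≢ i × y ≢ i × c' ≢ i))
  good-endpoint x y c e x≢i x≢j with t≢ e
  ... | _ , y≢c , _ with kind y | kind c
  ... | neither y≢i y≢j | neither c≢i c≢j = c , e , inj₁ (x≢j , y≢j , c≢j)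
  ... | neither y≢i y≢j | isI c≡i = c , e , inj₁ (x≢j , y≢j , λ q → i≢j (trans (sym c≡i) q))
  ... | neither y≢i y≢j | isJ c≡j = c , e , inj₂ (x≢i , y≢i , λ q → j≢i (trans (sym c≡j) q))
  ... | isI refl | isI refl = ⊥-elim (y≢c refl)
  ... | isI refl | isJ refl with other-end x i j e
  ...   | c' , e' , c'≢j = c' , e' , inj₁ (x≢j , i≢j , c'≢j)
  good-endpoint x y c e x≢i x≢j | _ , y≢c , _ | isI refl | neither c≢i c≢j = c , e , inj₁ (x≢j , i≢j , c≢j)
  good-endpoint x y c e x≢i x≢j | _ , y≢c , _ | isJ refl | isI refl with other-end x j i e
  ...   | c' , e' , c'≢i = c' , e' , inj₂ (x≢i , j≢i , c'≢i)
  good-endpoint x y c e x≢i x≢j | _ , y≢c , _ | isJ refl | isJ refl = ⊥-elim (y≢c refl)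
  good-endpoint x y c e x≢i x≢j | _ , y≢c , _ | isJ refl | neither c≢i c≢j = c , e , inj₂ (x≢i , j≢i , c≢i)

  swap-good : ∀ {x y c} → ((x ≢ j × y ≢ j × c ≢ j) ⊎ (x ≢ i × y ≢ i × c ≢ i)) →
    ((y ≢ j × x ≢ j × c ≢ j) ⊎ (y ≢ i × x ≢ i × c ≢ i))
  swap-good (inj₁ (a , b , c)) = inj₁ (b , a , c)
  swap-good (inj₂ (a , b , c)) = inj₂ (b , a , c)

  triQ-φ : ∀ x y c → T' (r x) (r y) (r c) ≡ true → triQ (φ x) (φ y) (φ c) ≡ true
  triQ-φ x y c e = subst (_≡ true) (sym (cong₃ T' (ιφ≡r x) (ιφ≡r y) (ιφ≡r c))) e

  adj-step : ∀ x y → AdjT T x y → φ x ≡ φ y ⊎ AdjT triQ (φ x) (φ y)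
  adj-step x y (c , e) with kind x
  ... | neither x≢i x≢j with good-endpoint x y c e x≢i x≢j
  ...   | c' , e' , good = inj₂ (φ c' , triQ-φ x y c' (vertex-survives x y c' e' good))
  adj-step x y (c , e) | isI _ with kind y
  ... | neither y≢i y≢j with good-endpoint y x c (P213 e) y≢i y≢j
  ...   | c' , e' , good = inj₂ (φ c' , triQ-φ x y c' (vertex-survives x y c' (P213 e') (swap-good good)))
  adj-step x y (c , e) | isI refl | isI refl = inj₁ refl
  adj-step x y (c , e) | isI refl | isJ refl = inj₁ (sym φj≡φi)
  adj-step x y (c , e) | isJ _ with kind y
  ... | neither y≢i y≢j with good-endpoint y x c (P213 e) y≢i y≢j
  ...   | c' , e' , good = inj₂ (φ c' , triQ-φ x y c' (vertex-survives x y c' (P213 e') (swap-good good)))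
  adj-step x y (c , e) | isJ refl | isI refl = inj₁ φj≡φi
  adj-step x y (c , e) | isJ refl | isJ refl = inj₁ refl

  reachQ : ∀ x y → Reach (AdjT T) x y → Reach (AdjT triQ) (φ x) (φ y)
  reachQ x .x here = here
  reachQ x y (step {y = z} a r) with adj-step x z a
  ... | inj₁ e rewrite e = reachQ z y r
  ... | inj₂ aq = step aq (reachQ z y r)

  connectedQ : ∀ a b → Reach (AdjT triQ) a b
  connectedQ a b = subst₂ (Reach (AdjT triQ)) (φι a) (φι b) (reachQ (ι a) (ι b) (connected (ι a) (ι b)))

  -- Euler's relation for Q: by count3-lengths, count3 is twice the total
  -- polygon length, and merging decreases that total by 6 (by 4 at the
  -- merged facet, by 1 at y1 and at y2) while removing one facet.
  lengths : sumᶠ kQ + 4 + 1 + 1 ≡ sumᶠ (λ a → kP (ι a)) + kP j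
  lengths = trans (sym corrections) (trans (sumᶠ-ext _ _ (λ a → proj₂ (cycleQ-with-length a))) merged)
    where
    corrections : sumᶠ (λ a → kQ a + δ a Fa 4 + δ a (φ y1) 1 + δ a (φ y2) 1) ≡ sumᶠ kQ + 4 + 1 + 1
    corrections = begin
      sumᶠ (λ a → kQ a + δ a Fa 4 + δ a (φ y1) 1 + δ a (φ y2) 1)
        ≡⟨ sumᶠ-+ (λ a → kQ a + δ a Fa 4 + δ a (φ y1) 1) (λ a → δ a (φ y2) 1) ⟩
      sumᶠ (λ a → kQ a + δ a Fa 4 + δ a (φ y1) 1) + sumᶠ (λ a → δ a (φ y2) 1)
        ≡⟨ cong₂ _+_ (sumᶠ-+ (λ a → kQ a + δ a Fa 4) (λ a → δ a (φ y1) 1)) (sumᶠ-ind (φ y2) 1) ⟩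
      sumᶠ (λ a → kQ a + δ a Fa 4) + sumᶠ (λ a → δ a (φ y1) 1) + 1
        ≡⟨ cong₂ (λ u v → u + v + 1) (sumᶠ-+ kQ (λ a → δ a Fa 4)) (sumᶠ-ind (φ y1) 1) ⟩
      sumᶠ kQ + sumᶠ (λ a → δ a Fa 4) + 1 + 1
        ≡⟨ cong (λ u → sumᶠ kQ + u + 1 + 1) (sumᶠ-ind Fa 4) ⟩
      sumᶠ kQ + 4 + 1 + 1 ∎
      where open ≡-Reasoning
    merged : sumᶠ (λ a → kP (ι a) + δ a Fa (kP j)) ≡ sumᶠ (λ a → kP (ι a)) + kP j
    merged = trans (sumᶠ-+ (λ a → kP (ι a)) (λ a → δ a Fa (kP j))) (cong (sumᶠ (λ a → kP (ι a)) +_) (sumᶠ-ind Fa (kP j)))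

  eulerQ : count3 triQ + 24 ≡ 12 * m
  eulerQ = +-cancelʳ-≡ 12 _ _ (begin
      count3 triQ + 24 + 12
        ≡⟨ cong (λ u → u + 24 + 12) (count3-lengths triQ symQ cycleQ) ⟩
      2 * sumᶠ kQ + 24 + 12
        ≡⟨ arith₁ (sumᶠ kQ) ⟩
      2 * (sumᶠ kQ + 4 + 1 + 1) + 24
        ≡⟨ cong (λ u → 2 * u + 24) lengths ⟩
      2 * (sumᶠ (λ a → kP (ι a)) + kP j) + 24
        ≡⟨ cong (λ u → 2 * u + 24) (trans (+-comm _ (kP j)) (sym (sumᶠ-punch j kP))) ⟩
      2 * sumᶠ kP + 24
        ≡⟨ cong (_+ 24) (sym (count3-lengths T (λ x → sym₂ x) cycleP)) ⟩
      count3 T + 24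
        ≡⟨ euler ⟩
      12 * suc m
        ≡⟨ arith₂ m ⟩
      12 * m + 12 ∎)
    where
    open ≡-Reasoning
    arith₁ : ∀ a → 2 * a + 24 + 12 ≡ 2 * (a + 4 + 1 + 1) + 24
    arith₁ = solve-∀
    arith₂ : ∀ m → 12 * suc m ≡ 12 * m + 12
    arith₂ = solve-∀

  Q-simple : IsSimple3Polytope m triQ
  Q-simple = record
    { irrefl = λ a c → ∨-false (F12 (ι a) (ι c)) (F12 (r' (ι a)) (r' (ι c)))
    ; sym₁ = λ a b c → cong₂ _∨_ (sym₁ (ι a) (ι b) (ι c)) (sym₁ (r' (ι a)) (r' (ι b)) (r' (ι c)))
    ; sym₂ = symQ
    ; nonempty = λ a → Cycle.w (cycleQ a) 0 , Cycle.w (cycleQ a) 1 ,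
                       Cycle.→edges (cycleQ a) 0 (≤-trans (s≤s z≤n) (Cycle.k≥3 (cycleQ a)))
    ; edge2 = λ a b adj → CycleFacts.deg2 (symQ a) (cycleQ a) b (proj₁ adj) (proj₂ adj)
    ; linkConn = λ a b c sb sc → CycleFacts.conn (symQ a) (cycleQ a) b c sb sc
    ; connected = connectedQ
    ; euler = eulerQ
    }

  Q : SimplePolytope
  Q = record { n = m ; tri = triQ ; isSimple = Q-simple }

  gQ : Fin K → Fin m
  gQ t = φ (g (toℕ t))

  EdgeFin : Fin m → Fin m → Fin K → Set
  EdgeFin b c t = (b ≡ gQ t × c ≡ gQ (next t)) ⊎ (b ≡ gQ (next t) × c ≡ gQ t)

  gQ-next : ∀ (t : Fin K) → gQ (next t) ≡ φ (g (suc (toℕ t)))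
  gQ-next t = at-next (λ u → φ (g u)) (cong φ g-wrap) t

  toEdgeFin : ∀ {b c t} (t<K : t < K) → EdgeAt (λ u → φ (g u)) t b c → EdgeFin b c (fromℕ< t<K)
  toEdgeFin {b} {c} {t} t<K = convert
    where
    at-t : gQ (fromℕ< t<K) ≡ φ (g t)
    at-t = cong (λ u → φ (g u)) (toℕ-fromℕ< t<K)
    at-t+1 : gQ (next (fromℕ< t<K)) ≡ φ (g (suc t))
    at-t+1 = trans (gQ-next (fromℕ< t<K)) (cong (λ u → φ (g (suc u))) (toℕ-fromℕ< t<K))
    convert : EdgeAt (λ u → φ (g u)) t b c → EdgeFin b c (fromℕ< t<K)
    convert (inj₁ (p , q)) = inj₁ (trans p (sym at-t) , trans q (sym at-t+1))
    convert (inj₂ (p , q)) = inj₂ (trans p (sym at-t+1) , trans q (sym at-t))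

  fromEdgeFin : ∀ {b c} (t : Fin K) → EdgeFin b c t → EdgeAt (λ u → φ (g u)) (toℕ t) b c
  fromEdgeFin t (inj₁ (p , q)) = inj₁ (p , trans q (gQ-next t))
  fromEdgeFin t (inj₂ (p , q)) = inj₂ (trans p (gQ-next t) , q)

  -- φ is injective away from j, so edges of φ ∘ g come from edges of g
  pullEdge : ∀ {b c t} → t < K → b ≢ j → c ≢ j → EdgeAt (λ u → φ (g u)) t (φ b) (φ c) → EdgeAt g t b c
  pullEdge t<K b≢j c≢j (inj₁ (p , q)) = inj₁ (φ-inj b≢j (g≢j _ t<K) p , φ-inj c≢j (MergedLink.avoid-suc _ t<K) q)
  pullEdge t<K b≢j c≢j (inj₂ (p , q)) = inj₂ (φ-inj b≢j (MergedLink.avoid-suc _ t<K) p , φ-inj c≢j (g≢j _ t<K) q)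

  merged-facet : FacetCycle Q Fa K gQ
  merged-facet = record
    { g-inj = λ t u e → toℕ-injective (g-inj (toℕ t) (toℕ u) (toℕ<n t) (toℕ<n u)
                          (φ-inj (g≢j _ (toℕ<n t)) (g≢j _ (toℕ<n u)) e))
    ; g-cyc = λ b c → mk⇔ (to b c) (from b c) }
    where
    to : ∀ b c → triQ Fa b c ≡ true → Σ (Fin K) λ t → EdgeFin b c t
    to b c e with Cycle.edges→ MergedLink.cycleQ b c e
    ... | t , t<K , edge = fromℕ< t<K , toEdgeFin t<K edge
    from : ∀ b c → (Σ (Fin K) λ t → EdgeFin b c t) → triQ Fa b c ≡ true
    from b c (t , edge) = edgeAt⇒R (symQ Fa) MergedLink.cycleQ (toℕ<n t) (fromEdgeFin t edge)

  -- P is the (ℓi, K)-truncation of Q at Fa: the vertices of i are the edges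
  -- of g up to index ℓi, those of j the edges after it, and the new edge
  -- i ∩ j has its endpoints on g 0 = y1 and g (ℓi + 1) = y2.

  i-vertex→ : ∀ b c → b ≢ j → c ≢ j → T i b c ≡ true → Σ (Fin K) λ t → toℕ t ≤ ℓi × EdgeFin (φ b) (φ c) t
  i-vertex→ b c b≢j c≢j e with Ci.edges→ b c e
  ... | s , s<k , edge with Ci.interior s b c s<k edge (λ q → b≢j (trans q wi0)) (λ q → c≢j (trans q wi0))
  ... | s' , refl , lt = fromℕ< s'<K , subst (_≤ ℓi) (sym (toℕ-fromℕ< s'<K)) (≤-pred (≤-pred s'+1<Ki)) ,
          toEdgeFin s'<K (edgeAt-map {w = g} {t = s'} φ
            (edgeAt-cong {w = Ci.w} {v = g} {s = suc s'} {t = s'} (g-lo s' s'<Ki) (g-lo (suc s') s'+1<Ki) edge))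
    where
    s'+1<Ki : suc s' < Ki
    s'+1<Ki = ≤-pred (<i' lt)
    s'<Ki : s' < Ki
    s'<Ki = <-trans (n<1+n s') s'+1<Ki
    s'<K : s' < K
    s'<K = ≤-trans s'<Ki (m≤m+n Ki ℓj)

  i-vertex← : ∀ b c → b ≢ j → c ≢ j → (Σ (Fin K) λ t → toℕ t ≤ ℓi × EdgeFin (φ b) (φ c) t) → T i b c ≡ true
  i-vertex← b c b≢j c≢j (t , t≤ℓi , edge) = edgeAt⇒R (sym₂ i) (proj₁ Ci') (<i (s≤s (s≤s (m≤n⇒m≤1+n t≤ℓi))))
      (edgeAt-cong {w = g} {v = Ci.w} {s = toℕ t} {t = suc (toℕ t)} (sym (g-lo (toℕ t) t<Ki)) (sym (g-lo (suc (toℕ t)) t+1<Ki))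
        (pullEdge (toℕ<n t) b≢j c≢j (fromEdgeFin t edge)))
    where
    t+1<Ki : suc (toℕ t) < Ki
    t+1<Ki = s≤s (s≤s t≤ℓi)
    t<Ki : toℕ t < Ki
    t<Ki = <-trans (n<1+n _) t+1<Ki

  j-vertex→ : ∀ b c → b ≢ i → c ≢ i → T j b c ≡ true → Σ (Fin K) λ t → ℓi < toℕ t × EdgeFin (φ b) (φ c) t
  j-vertex→ b c b≢i c≢i e with Cj.edges→ b c e
  ... | u , u<k , edge with Cj.interior u b c u<k edge (λ q → b≢i (trans q wj0)) (λ q → c≢i (trans q wj0))
  ... | zero , refl , _ = fromℕ< Ki-1<K , subst (ℓi <_) (sym (toℕ-fromℕ< Ki-1<K)) ≤-refl ,
          toEdgeFin Ki-1<K (edgeAt-map {w = g} {t = 1 + ℓi} φ (edgeAt-cong {w = Cj.w} {v = g} {s = 1} {t = 1 + ℓi} (trans g-y2 (sym wj1))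
            (trans (cong g (sym (+-identityʳ Ki))) (g-hi 0)) edge))
    where
    Ki-1<K : 1 + ℓi < K
    Ki-1<K = m≤m+n Ki ℓj
  ... | suc v , refl , lt = fromℕ< Ki+v<K , subst (ℓi <_) (sym (toℕ-fromℕ< Ki+v<K)) (≤-trans (n≤1+n _) (m≤m+n Ki v)) ,
          toEdgeFin Ki+v<K (edgeAt-map {w = g} {t = Ki + v} φ (edgeAt-cong {w = Cj.w} {v = g} {s = 2 + v} {t = Ki + v} (g-hi v)
            (trans (cong g (sym (+-suc Ki v))) (g-hi (suc v))) edge))
    where
    Ki+v<K : Ki + v < K
    Ki+v<K = +-monoʳ-< Ki (≤-pred (≤-pred (≤-pred (<j' lt))))

  j-vertex← : ∀ b c → b ≢ j → c ≢ j → (Σ (Fin K) λ t → ℓi < toℕ t × EdgeFin (φ b) (φ c) t) → T j b c ≡ true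
  j-vertex← b c b≢j c≢j (t , ℓi<t , edge) with split-index (toℕ t) (toℕ<n t) | pullEdge (toℕ<n t) b≢j c≢j (fromEdgeFin t edge)
  ... | inj₁ t<Ki | edge' = edgeAt⇒R (sym₂ j) (proj₁ Cj') (<j (s≤s (s≤s z≤n)))
        (edgeAt-cong {w = g} {v = Cj.w} {s = toℕ t} {t = 1} (trans wj1 (sym (trans (cong g t≡) g-y2)))
          (sym (trans (cong g (trans (cong suc t≡) (sym (+-identityʳ Ki)))) (g-hi 0))) edge')
    where
    t≡ : toℕ t ≡ 1 + ℓi
    t≡ = ≤-antisym (≤-pred t<Ki) ℓi<t
  ... | inj₂ (u , t≡ , u<ℓj) | edge' = edgeAt⇒R (sym₂ j) (proj₁ Cj') (<j (s≤s (s≤s (s≤s (<⇒≤ u<ℓj)))))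
        (edgeAt-cong {w = g} {v = Cj.w} {s = toℕ t} {t = 2 + u} (sym (trans (cong g t≡) (g-hi u)))
          (sym (trans (cong g (trans (cong suc t≡) (sym (+-suc Ki u)))) (g-hi (suc u)))) edge')

  new-vertex→ : ∀ b → b ≢ j → T i j b ≡ true → Σ (Fin K) λ t → (toℕ t ≡ 0 ⊎ toℕ t ≡ suc ℓi) × φ b ≡ gQ t
  new-vertex→ b b≢j e with y-only b e
  ... | inj₁ refl = fromℕ< 0<K , inj₁ (toℕ-fromℕ< 0<K) , cong φ (sym (trans (cong g (toℕ-fromℕ< 0<K)) g0))
    where
    0<K : 0 < K
    0<K = ≤-trans (s≤s z≤n) K≥3
  ... | inj₂ refl = fromℕ< Ki-1<K , inj₂ (toℕ-fromℕ< Ki-1<K) , cong φ (sym (trans (cong g (toℕ-fromℕ< Ki-1<K)) g-y2))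
    where
    Ki-1<K : 1 + ℓi < K
    Ki-1<K = m≤m+n Ki ℓj

  new-vertex← : ∀ b → b ≢ j → (Σ (Fin K) λ t → (toℕ t ≡ 0 ⊎ toℕ t ≡ suc ℓi) × φ b ≡ gQ t) → T i j b ≡ true
  new-vertex← b b≢j (t , inj₁ t≡0 , p) =
    subst (λ z → T i j z ≡ true) (sym (φ-inj b≢j y1≢j (trans p (cong φ (trans (cong g t≡0) g0))))) Ty1
  new-vertex← b b≢j (t , inj₂ t≡Ki-1 , p) =
    subst (λ z → T i j z ≡ true) (sym (φ-inj b≢j y2≢j (trans p (cong φ (trans (cong g t≡Ki-1) g-y2))))) Ty2

  φ-fibres : ∀ x y → φ x ≡ φ y → x ≡ y ⊎ (x ≡ i × y ≡ j) ⊎ (x ≡ j × y ≡ i)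
  φ-fibres x y e with kind x | kind y
  ... | isI refl | isI refl = inj₁ refl
  ... | isI refl | isJ refl = inj₂ (inj₁ (refl , refl))
  ... | isJ refl | isI refl = inj₂ (inj₂ (refl , refl))
  ... | isJ refl | isJ refl = inj₁ refl
  ... | neither _ x≢j | neither _ y≢j = inj₁ (φ-inj x≢j y≢j e)
  ... | isI refl | neither _ y≢j = inj₁ (φ-inj i≢j y≢j e)
  ... | neither _ x≢j | isI refl = inj₁ (φ-inj x≢j i≢j e)
  ... | isJ refl | neither y≢i y≢j = ⊥-elim (y≢i (sym (φ-inj i≢j y≢j (trans (sym φj≡φi) e))))
  ... | neither x≢i x≢j | isJ refl = ⊥-elim (x≢i (φ-inj x≢j i≢j (trans e φj≡φi)))

  old-vertex : ∀ a b c → a ≢ i → a ≢ j → b ≢ i → b ≢ j → c ≢ i → c ≢ j → T a b c ≡ triQ (φ a) (φ b) (φ c)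
  old-vertex a b c a≢i a≢j b≢i b≢j c≢i c≢j = sym (begin
    T' (ι (φ a)) (ι (φ b)) (ι (φ c)) ≡⟨ cong₃ T' (ιφ a a≢j) (ιφ b b≢j) (ιφ c c≢j) ⟩
    T a b c ∨ T (r' a) (r' b) (r' c)  ≡⟨ cong (T a b c ∨_) (cong₃ T (r'-≢ a≢i) (r'-≢ b≢i) (r'-≢ c≢i)) ⟩
    T a b c ∨ T a b c                 ≡⟨ ∨-idem _ ⟩
    T a b c                           ∎)
    where open ≡-Reasoning

  truncation : Truncation P Q i j
  truncation = record
    { F = Fa ; k = K ; g = gQ ; cyc = merged-facet ; s = ℓi
    ; s≤k-2 = ≤-trans (≤-reflexive (+-comm ℓi 2)) (m≤m+n Ki ℓj)
    ; φ = φ ; i≢j = i≢j ; φi = refl ; φj = φj≡φi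
    ; φ-inj = φ-fibres
    ; φ-sur = λ z → ι z , φι z
    ; oldV = old-vertex
    ; F'V = λ b c _ b≢j _ c≢j → mk⇔ (i-vertex→ b c b≢j c≢j) (i-vertex← b c b≢j c≢j)
    ; F''V = λ b c b≢i b≢j c≢i c≢j → mk⇔ (j-vertex→ b c b≢i c≢i) (j-vertex← b c b≢j c≢j)
    ; newV = λ b _ b≢j → mk⇔ (new-vertex→ b b≢j) (new-vertex← b b≢j)
    }

straightening-iff-no-belt : (P : SimplePolytope) → ¬ IsTetrahedron P →
      ∀ i j → IsEdge P i j →
      (StraighteningDefined P i j ⇔ (¬ Σ (Fin (n P)) λ k → Belt3 P i j k))
straightening-iff-no-belt record { n = zero } _ () j _
straightening-iff-no-belt P@(record { n = suc m ; tri = T ; isSimple = SP }) not-tet i j eij = mk⇔ to from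
  where
  to : StraighteningDefined P i j → ¬ Σ (Fin (n P)) λ k → Belt3 P i j k
  to (Q , inj₁ tr) (k , belt) = truncation-edge-in-no-belt P Q i j tr k belt
  to (Q , inj₂ tr) (k , belt) = truncation-edge-in-no-belt P Q j i tr k (belt-swap P i j k belt)
  from : (¬ Σ (Fin (n P)) λ k → Belt3 P i j k) → StraighteningDefined P i j
  from no-belt = Straighten.Q m T SP i j eij no-belt not-tet , inj₁ (Straighten.truncation m T SP i j eij no-belt not-tet)

corollary4p8 : ((P : SimplePolytope) → IsTetrahedron P →
    ∀ i j → IsEdge P i j → ¬ StraighteningDefined P i j)
    ×
    ((P : SimplePolytope) → ¬ IsTetrahedron P →
    ∀ i j → IsEdge P i j →
    (StraighteningDefined P i j ⇔ (¬ Σ (Fin (n P)) λ k → Belt3 P i j k)))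
corollary4p8 = tetrahedron-no-straightening , straightening-iff-no-belt
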